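{- Let $k\ge 1$ and let $I=(i_1,\ldots,i_k)$ with $0\le i_1<\cdots<i_k$ and $J=(j_1,\ldots,j_k)$ with $0\le j_1<\cdots<j_k$ be integer sequences. Let $L^B_{I,J}$ be the submatrix of $L^B$ with rows indexed by $I$ and columns indexed by $J$, let $\mathbf{P}_I=(P_{i_1},\ldots,P_{i_k})$ and $\mathbf{P}'_J=(P'_{j_1},\ldots,P'_{j_k})$, and let $S_{I,J}$ be the set of nonintersecting families $\mathbf{p}=(p_1,\ldots,p_k)\in\mathcal{N}_{D^{L^B}}(\mathbf{P}_I,\mathbf{P}'_J)$ that satisfy none of the properties $(\mathcal{P}_1)$, $(\mathcal{P}_2)$, $(\mathcal{P}_3)$. Then $$\det\left[L^B_{I,J}\right]=GF(S_{I,J}),$$ the sum of the weights of all elements of $S_{I,J}$. In particular, $\det[L^B_{I,J}]$ is a polynomial in $q$ with nonnegative coefficients.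
   Context: $L^B=(l_{i,j})_{i,j\ge 0}$ is the infinite lower triangular matrix with entries in $\mathbb{Z}[q]$ given by $l_{i,i}=1$ for $i\ge0$, $l_{1,0}=1+q$, $l_{2,0}=2q$, $l_{i+1,i}=1+q$ for $i\ge 1$, $l_{i+2,i}=q$ for $i\ge 1$, and $l_{i,j}=0$ otherwise. (It is the coefficient matrix of the triangle $b_{n,0}=(1+q)b_{n-1,0}+2q\,b_{n-1,1}$, $b_{n,k}=b_{n-1,k-1}+(1+q)b_{n-1,k}+q\,b_{n-1,k+1}$.) The weighted directed graph $D^{L^B}$ has vertices $P_i=(0,-i)$, $Q_i=(1,-i)$, $P'_i=(2,-i)$ for $i\ge0$, and arcs: $P_i\to Q_i$ ($i\ge0$); $P_i\to Q_{i-1}$ ($i\ge1$); $Q_i\to P'_i$ ($i\ge0$); $Q_i\to P'_{i-1}$ ($i\ge2$); $P_1\to P'_0$; and two distinct parallel arcs $Q_1\overset{l}{\to}P'_0$ and $Q_1\overset{r}{\to}P'_0$. Weights: $P_1\to P'_0$ has weight $-1$, each $P_i\to Q_{i-1}$ ($i\ge1$) has weight $q$, all other arcs have weight $1$. (With these weights, $l_{i,j}$ equals the sum of weights of directed paths from $P_i$ to $P'_j$.) The weight of a directed path is the product of the weights of its arcs; the weight of a family of paths is the product of the weights of its paths. $\mathcal{N}_{D^{L^B}}(\mathbf{P}_I,\mathbf{P}'_J)$ is the set of tuples $(p_1,\ldots,p_k)$ of directed paths, $p_m$ from $P_{i_m}$ to $P'_{j_m}$, that are pairwise vertex-disjoint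 (nonintersecting). Properties of a family $\mathbf{p}=(p_1,\ldots,p_k)$: $(\mathcal{P}_1)$: $p_1$ is the path $P_1\to P'_0$ (the single arc). $(\mathcal{P}_2)$: $p_1$ is the path $P_1\to Q_1\overset{l}{\to}P'_0$. $(\mathcal{P}_3)$: there exists $l\ge2$ such that $p_m$ is the path $P_m\to Q_{m-1}\to P'_{m-1}$ for all $1\le m\le l-1$ and $p_l$ is the path $P_l\to Q_l\to P'_{l-1}$. -}

module Defs where

open import Data.Nat as ℕ using (ℕ; zero; suc)
open import Data.Integer as ℤ using (ℤ; +_; 0ℤ; 1ℤ)
open import Data.Fin using (Fin; zero; suc; toℕ; punchIn)
open import Data.Fin as Fin using ()
open import Data.List using (List; []; _∷_; map)
open import Data.List.Membership.Propositional using (_∈_)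
open import Data.Vec using (Vec; lookup)
open import Data.Product using (Σ; Σ-syntax; ∃; ∃-syntax; _×_; _,_; proj₁; proj₂)
open import Data.Sum using (_⊎_)
open import Data.Empty using (⊥)
open import Relation.Nullary using (¬_)
open import Relation.Binary.PropositionalEquality using (_≡_)

-- Polynomials in ℤ[q]: coefficient lists (constant term first).

Poly : Set
Poly = List ℤ

coeff : Poly → ℕ → ℤ
coeff []      _       = 0ℤ
coeff (a ∷ p) zero    = a
coeff (a ∷ p) (suc n) = coeff p n

_≈ₚ_ : Poly → Poly → Set
p ≈ₚ r = (n : ℕ) → coeff p n ≡ coeff r n

infix 4 _≈ₚ_
infixl 6 _+ₚ_
infixl 7 _*ₚ_

_+ₚ_ : Poly → Poly → Poly
[]      +ₚ r       = r
(a ∷ p) +ₚ []      = a ∷ p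
(a ∷ p) +ₚ (b ∷ r) = (a ℤ.+ b) ∷ (p +ₚ r)

_*ₚ_ : Poly → Poly → Poly
[]      *ₚ r = []
(a ∷ p) *ₚ r = map (a ℤ.*_) r +ₚ (0ℤ ∷ (p *ₚ r))

-ₚ_ : Poly → Poly
-ₚ p = map ℤ.-_ p

0ₚ 1ₚ qₚ : Poly
0ₚ = []
1ₚ = 1ℤ ∷ []
qₚ = 0ℤ ∷ 1ℤ ∷ []

constₚ : ℤ → Poly
constₚ a = a ∷ []

sumFin : (n : ℕ) → (Fin n → Poly) → Poly
sumFin zero    f = 0ₚ
sumFin (suc n) f = f zero +ₚ sumFin n (λ j → f (suc j))

signed : ℕ → Poly → Poly
signed zero    p = p
signed (suc m) p = -ₚ (signed m p)

det : (n : ℕ) → (Fin n → Fin n → Poly) → Poly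
det zero    M = 1ₚ
det (suc n) M = sumFin (suc n) (λ j →
  signed (toℕ j) (M zero j *ₚ det n (λ a b → M (suc a) (punchIn j b))))

LB : ℕ → ℕ → Poly
LB 0 0 = 1ₚ
LB 1 0 = 1ℤ ∷ 1ℤ ∷ []
LB 2 0 = 0ℤ ∷ (+ 2) ∷ []
LB (suc (suc i)) (suc j) with i ℕ.≟ j
... | Relation.Nullary.yes _ = 1ℤ ∷ 1ℤ ∷ []   -- l_{j+2,j+1} = 1+q   (j+1 ≥ 1)
... | Relation.Nullary.no _ with suc i ℕ.≟ j
...    | Relation.Nullary.yes _ = 1ₚ         -- diagonal l_{j+1,j+1} = 1
...    | Relation.Nullary.no _ with i ℕ.≟ suc j
...       | Relation.Nullary.yes _ = qₚ       -- l_{j+3,j+1} = q  (j+1 ≥ 1)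
...       | Relation.Nullary.no _ = 0ₚ
LB (suc zero) (suc zero) = 1ₚ
LB _ _ = 0ₚ

subLB : {k : ℕ} → (Fin k → ℕ) → (Fin k → ℕ) → Fin k → Fin k → Poly
subLB I J a b = LB (I a) (J b)

StrictlyIncreasing : {k : ℕ} → (Fin k → ℕ) → Set
StrictlyIncreasing {k} I = (a b : Fin k) → a Fin.< b → I a ℕ.< I b

data Vertex : Set where
  P  : ℕ → Vertex     -- P_i  = (0,-i)
  Q  : ℕ → Vertex     -- Q_i  = (1,-i)
  P' : ℕ → Vertex     -- P'_i = (2,-i)

data Arc : Vertex → Vertex → Set where
  PQ    : (i : ℕ) → Arc (P i) (Q i)
  PQ↑   : (i : ℕ) → Arc (P (suc i)) (Q i)
  QP'   : (i : ℕ) → Arc (Q i) (P' i)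
  QP'↑  : (i : ℕ) → Arc (Q (suc (suc i))) (P' (suc i))
  P1P'0 : Arc (P 1) (P' 0)
  Q1l   : Arc (Q 1) (P' 0)
  Q1r   : Arc (Q 1) (P' 0)

arcWeight : {u v : Vertex} → Arc u v → Poly
arcWeight (PQ i)   = 1ₚ
arcWeight (PQ↑ i)  = qₚ
arcWeight (QP' i)  = 1ₚ
arcWeight (QP'↑ i) = 1ₚ
arcWeight P1P'0    = constₚ (ℤ.- 1ℤ)
arcWeight Q1l      = 1ₚ
arcWeight Q1r      = 1ₚ

data Path : Vertex → Vertex → Set where
  []  : {v : Vertex} → Path v v
  _∷_ : {u v w : Vertex} → Arc u v → Path v w → Path u w

pathWeight : {u v : Vertex} → Path u v → Poly
pathWeight []      = 1ₚ
pathWeight (a ∷ p) = arcWeight a *ₚ pathWeight p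

vertices : {u v : Vertex} → Path u v → List Vertex
vertices {v = v} []  = v ∷ []
vertices {u = u} (a ∷ p) = u ∷ vertices p

record AnyPath : Set where
  constructor path
  field
    start : Vertex
    end   : Vertex
    arcs  : Path start end
open AnyPath public

Family : ℕ → Set
Family k = Vec AnyPath k

familyWeight : {k : ℕ} → Family k → Poly
familyWeight Data.Vec.[] = 1ₚ
familyWeight (p Data.Vec.∷ f) = pathWeight (arcs p) *ₚ familyWeight f

Nonintersecting : {k : ℕ} → (Fin k → ℕ) → (Fin k → ℕ) → Family k → Set
Nonintersecting {k} I J f =
  ((m : Fin k) → (start (lookup f m) ≡ P (I m)) × (end (lookup f m) ≡ P' (J m)))
  × ((m m' : Fin k) → ¬ (m ≡ m') → (x : Vertex) →
       x ∈ vertices (arcs (lookup f m)) → x ∈ vertices (arcs (lookup f m')) → ⊥)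

Prop₁ : {n : ℕ} → Family (suc n) → Set
Prop₁ f = lookup f zero ≡ path (P 1) (P' 0) (P1P'0 ∷ [])

Prop₂ : {n : ℕ} → Family (suc n) → Set
Prop₂ f = lookup f zero ≡ path (P 1) (P' 0) (PQ 1 ∷ (Q1l ∷ []))

-- (𝒫₃): ∃ l ≥ 2 (written l = u + 2, at 0-based position t with toℕ t = u + 1)
--   p_m = P_m → Q_{m-1} → P'_{m-1} for 1 ≤ m ≤ l-1 (0-based positions s < u+1, m = s+1),
--   p_l = P_l → Q_l → P'_{l-1}.
Prop₃ : {n : ℕ} → Family (suc n) → Set
Prop₃ {n} f = Σ[ u ∈ ℕ ] Σ[ t ∈ Fin (suc n) ] (toℕ t ≡ suc u)
  × ((s : Fin (suc n)) → toℕ s ℕ.< suc u →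
       lookup f s ≡ path (P (suc (toℕ s))) (P' (toℕ s)) (PQ↑ (toℕ s) ∷ (QP' (toℕ s) ∷ [])))
  × (lookup f t ≡ path (P (suc (suc u))) (P' (suc u)) (PQ (suc (suc u)) ∷ (QP'↑ u ∷ [])))

InS : {n : ℕ} → (Fin (suc n) → ℕ) → (Fin (suc n) → ℕ) → Family (suc n) → Set
InS I J f = Nonintersecting I J f × ¬ Prop₁ f × ¬ Prop₂ f × ¬ Prop₃ f

GF : {k : ℕ} → List (Family k) → Poly
GF []       = 0ₚ
GF (f ∷ fs) = familyWeight f +ₚ GF fs

{-# OPTIONS --safe #-}
-- A path from P_i to P'_j passes through Q_i or Q_{i-1} (or is the arc P_1 → P'_0), so in a family
-- with strictly increasing starts and ends only consecutive paths can meet, and then only in the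
-- Q-vertex of the earlier one.  The nonintersecting families are therefore enumerated path by path,
-- each first path filtering the tail families by its Q-vertex.  Expanding det L^B_{I,J} along its
-- first row and inducting on k shows that it is the generating function of all these families; the
-- only first rows with two nonzero entries have i_1 = j_1 + 1, and then the second cofactor is, by
-- induction, (number of arcs Q_{i_1} → P'_{j_1}) times the weight of the tail families passing
-- through Q_{i_1}.  The families with (𝒫₁), (𝒫₂) or (𝒫₃) start with a path P_1 → P'_0 and cancel:
-- the direct arc gives −GF(tails), the l-arc gives the tails avoiding Q_1, and the q-weighted path
-- through Q_0 followed by a staircase gives the tails through Q_1, since
-- q · GF(staircases from Q_m) = GF(tails through Q_m).  Every remaining path avoids the arc of
-- weight −1, so the determinant has nonnegative coefficients.
module Submission where

open import Defs
open import Level using (0ℓ)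
open import Function using (_∘_)
open import Data.Nat as ℕ using (ℕ; zero; suc; _+_; _≤_; _<_; z≤n; s≤s)
import Data.Nat.Properties as ℕP
open import Data.Integer as ℤ using (ℤ; +_; 0ℤ; 1ℤ; +≤+) renaming (_≤_ to _≤ℤ_)
import Data.Integer.Properties as ℤP
open import Algebra.Properties.CommutativeSemigroup ℤP.+-commutativeSemigroup using (interchange)
open import Data.Fin using (Fin; zero; suc; toℕ; punchIn)
import Data.Fin.Properties as FinP
open import Data.List using (List; []; _∷_; map; _++_; filter)
open import Data.List.Properties using (filter-all; filter-none; filter-++; filter-≐)
open import Data.List.Membership.Propositional using (_∈_)
open import Data.List.Membership.Propositional.Properties
  using (∈-++⁻; ∈-++⁺ˡ; ∈-++⁺ʳ; ∈-map⁻; ∈-map⁺; ∈-filter⁻; ∈-filter⁺)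
open import Data.List.Relation.Unary.All as All using (All; []; _∷_)
open import Data.List.Relation.Unary.AllPairs using ([]; _∷_)
open import Data.List.Relation.Unary.Any using (here; there)
open import Data.List.Relation.Unary.Unique.Propositional using (Unique)
import Data.List.Relation.Unary.Unique.Propositional.Properties as Unique
open import Data.Vec using ([]; _∷_; lookup)
open import Data.Maybe using (Maybe; just; nothing)
import Data.Maybe.Properties as Maybe
open import Data.Product using (Σ-syntax; ∃-syntax; _×_; _,_; proj₁; proj₂)
open import Data.Sum using (_⊎_; inj₁; inj₂; [_,_])
open import Data.Empty using (⊥)
open import Data.Unit using (⊤; tt)
open import Relation.Nullary using (¬_; Dec; yes; no; ¬?; contradiction)
open import Relation.Nullary.Decidable using (map′; _⊎-dec_; _×-dec_)
open import Relation.Unary using (Pred; Decidable; _≐_)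
open import Relation.Binary.Bundles using (Setoid)
open import Relation.Binary.Definitions using (tri<; tri≈; tri>)
open import Relation.Binary.PropositionalEquality hiding ([_])
open import Algebra.Bundles using (CommutativeRing)
open import Algebra.Solver.Ring.AlmostCommutativeRing using (fromCommutativeRing; _-Raw-AlmostCommutative⟶_)
import Algebra.Solver.Ring
import Relation.Binary.Reasoning.Setoid

-- The ring ℤ[q] of coefficient lists

infix 4 _≋_

-- _≈ₚ_ is a function type from which Agda cannot recover the two polynomials; the record can.

record _≋_ (p r : Poly) : Set where
  constructor coeffwise
  field coeff≡ : p ≈ₚ r
open _≋_ public

≋-refl : ∀ {p} → p ≋ p
≋-refl = coeffwise λ _ → refl

≋-sym : ∀ {p r} → p ≋ r → r ≋ p
≋-sym e = coeffwise λ n → sym (coeff≡ e n)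

≋-trans : ∀ {p r s} → p ≋ r → r ≋ s → p ≋ s
≋-trans e f = coeffwise λ n → trans (coeff≡ e n) (coeff≡ f n)

≋-setoid : Setoid 0ℓ 0ℓ
≋-setoid = record
  { Carrier = Poly ; _≈_ = _≋_
  ; isEquivalence = record { refl = ≋-refl ; sym = ≋-sym ; trans = ≋-trans } }

module ≋-Reasoning = Relation.Binary.Reasoning.Setoid ≋-setoid

≡⇒≋ : ∀ {p r} → p ≡ r → p ≋ r
≡⇒≋ refl = ≋-refl

scale : ℤ → Poly → Poly
scale a = map (a ℤ.*_)

coeff-+ₚ : ∀ p r n → coeff (p +ₚ r) n ≡ coeff p n ℤ.+ coeff r n
coeff-+ₚ []      r       n       = sym (ℤP.+-identityˡ _)
coeff-+ₚ (a ∷ p) []      n       = sym (ℤP.+-identityʳ _)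
coeff-+ₚ (a ∷ p) (b ∷ r) zero    = refl
coeff-+ₚ (a ∷ p) (b ∷ r) (suc n) = coeff-+ₚ p r n

coeff-map : ∀ (f : ℤ → ℤ) → f 0ℤ ≡ 0ℤ → ∀ p n → coeff (map f p) n ≡ f (coeff p n)
coeff-map f f0 []      n       = sym f0
coeff-map f f0 (a ∷ p) zero    = refl
coeff-map f f0 (a ∷ p) (suc n) = coeff-map f f0 p n

coeff-scale : ∀ a p n → coeff (scale a p) n ≡ a ℤ.* coeff p n
coeff-scale a = coeff-map (a ℤ.*_) (ℤP.*-zeroʳ a)

coeff-neg : ∀ p n → coeff (-ₚ p) n ≡ ℤ.- coeff p n
coeff-neg = coeff-map ℤ.-_ refl

∷-cong : ∀ {a b p r} → a ≡ b → p ≋ r → a ∷ p ≋ b ∷ r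
∷-cong a≡b p≋r = coeffwise λ where
  zero    → a≡b
  (suc n) → coeff≡ p≋r n

∷-tail : ∀ {a b p r} → a ∷ p ≋ b ∷ r → p ≋ r
∷-tail e = coeffwise λ n → coeff≡ e (suc n)

0ₚ≋0∷ : ∀ {p} → 0ₚ ≋ p → 0ₚ ≋ 0ℤ ∷ p
0ₚ≋0∷ e = coeffwise λ where
  zero    → refl
  (suc n) → coeff≡ e n

+ₚ-cong : ∀ {p p′ r r′} → p ≋ p′ → r ≋ r′ → p +ₚ r ≋ p′ +ₚ r′
+ₚ-cong {p} {p′} {r} {r′} e f = coeffwise λ n → begin
  coeff (p +ₚ r) n             ≡⟨ coeff-+ₚ p r n ⟩
  coeff p n ℤ.+ coeff r n      ≡⟨ cong₂ ℤ._+_ (coeff≡ e n) (coeff≡ f n) ⟩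
  coeff p′ n ℤ.+ coeff r′ n    ≡⟨ coeff-+ₚ p′ r′ n ⟨
  coeff (p′ +ₚ r′) n           ∎
  where open ≡-Reasoning

+ₚ-assoc : ∀ p r s → (p +ₚ r) +ₚ s ≋ p +ₚ (r +ₚ s)
+ₚ-assoc p r s = coeffwise λ n → begin
  coeff ((p +ₚ r) +ₚ s) n                      ≡⟨ coeff-+ₚ (p +ₚ r) s n ⟩
  coeff (p +ₚ r) n ℤ.+ coeff s n               ≡⟨ cong (ℤ._+ coeff s n) (coeff-+ₚ p r n) ⟩
  (coeff p n ℤ.+ coeff r n) ℤ.+ coeff s n      ≡⟨ ℤP.+-assoc (coeff p n) (coeff r n) (coeff s n) ⟩
  coeff p n ℤ.+ (coeff r n ℤ.+ coeff s n)      ≡⟨ cong (ℤ._+_ (coeff p n)) (coeff-+ₚ r s n) ⟨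
  coeff p n ℤ.+ coeff (r +ₚ s) n               ≡⟨ coeff-+ₚ p (r +ₚ s) n ⟨
  coeff (p +ₚ (r +ₚ s)) n                      ∎
  where open ≡-Reasoning

+ₚ-comm : ∀ p r → p +ₚ r ≋ r +ₚ p
+ₚ-comm p r = coeffwise λ n →
  trans (coeff-+ₚ p r n) (trans (ℤP.+-comm (coeff p n) (coeff r n)) (sym (coeff-+ₚ r p n)))

+ₚ-identityˡ : ∀ p → 0ₚ +ₚ p ≋ p
+ₚ-identityˡ p = ≋-refl

+ₚ-identityʳ : ∀ p → p +ₚ 0ₚ ≋ p
+ₚ-identityʳ p = coeffwise λ n → trans (coeff-+ₚ p [] n) (ℤP.+-identityʳ _)

-ₚ-cong : ∀ {p r} → p ≋ r → -ₚ p ≋ -ₚ r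
-ₚ-cong {p} {r} e = coeffwise λ n →
  trans (coeff-neg p n) (trans (cong ℤ.-_ (coeff≡ e n)) (sym (coeff-neg r n)))

-ₚ-inverseˡ : ∀ p → (-ₚ p) +ₚ p ≋ 0ₚ
-ₚ-inverseˡ p = coeffwise λ n →
  trans (coeff-+ₚ (-ₚ p) p n) (trans (cong (ℤ._+ coeff p n) (coeff-neg p n)) (ℤP.+-inverseˡ (coeff p n)))

-ₚ-inverseʳ : ∀ p → p +ₚ (-ₚ p) ≋ 0ₚ
-ₚ-inverseʳ p = ≋-trans (+ₚ-comm p (-ₚ p)) (-ₚ-inverseˡ p)

scale-cong : ∀ a {p r} → p ≋ r → scale a p ≋ scale a r
scale-cong a {p} {r} e = coeffwise λ n →
  trans (coeff-scale a p n) (trans (cong (a ℤ.*_) (coeff≡ e n)) (sym (coeff-scale a r n)))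

scale-distribˡ : ∀ a r s → scale a (r +ₚ s) ≋ scale a r +ₚ scale a s
scale-distribˡ a r s = coeffwise λ n → begin
  coeff (scale a (r +ₚ s)) n                      ≡⟨ coeff-scale a (r +ₚ s) n ⟩
  a ℤ.* coeff (r +ₚ s) n                          ≡⟨ cong (ℤ._*_ a) (coeff-+ₚ r s n) ⟩
  a ℤ.* (coeff r n ℤ.+ coeff s n)                 ≡⟨ ℤP.*-distribˡ-+ a (coeff r n) (coeff s n) ⟩
  a ℤ.* coeff r n ℤ.+ a ℤ.* coeff s n             ≡⟨ cong₂ ℤ._+_ (coeff-scale a r n) (coeff-scale a s n) ⟨
  coeff (scale a r) n ℤ.+ coeff (scale a s) n     ≡⟨ coeff-+ₚ (scale a r) (scale a s) n ⟨
  coeff (scale a r +ₚ scale a s) n                ∎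
  where open ≡-Reasoning

scale-distribʳ : ∀ a b r → scale (a ℤ.+ b) r ≋ scale a r +ₚ scale b r
scale-distribʳ a b r = coeffwise λ n → begin
  coeff (scale (a ℤ.+ b) r) n                     ≡⟨ coeff-scale (a ℤ.+ b) r n ⟩
  (a ℤ.+ b) ℤ.* coeff r n                         ≡⟨ ℤP.*-distribʳ-+ (coeff r n) a b ⟩
  a ℤ.* coeff r n ℤ.+ b ℤ.* coeff r n             ≡⟨ cong₂ ℤ._+_ (coeff-scale a r n) (coeff-scale b r n) ⟨
  coeff (scale a r) n ℤ.+ coeff (scale b r) n     ≡⟨ coeff-+ₚ (scale a r) (scale b r) n ⟨
  coeff (scale a r +ₚ scale b r) n                ∎
  where open ≡-Reasoning

scale-zero : ∀ {a} p → a ≡ 0ℤ → scale a p ≋ 0ₚ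
scale-zero {a} p refl = coeffwise λ n → trans (coeff-scale 0ℤ p n) (ℤP.*-zeroˡ (coeff p n))

+ₚ-interchange : ∀ p r s t → (p +ₚ r) +ₚ (s +ₚ t) ≋ (p +ₚ s) +ₚ (r +ₚ t)
+ₚ-interchange p r s t = coeffwise λ n → begin
  coeff ((p +ₚ r) +ₚ (s +ₚ t)) n
    ≡⟨ coeff-+ₚ (p +ₚ r) (s +ₚ t) n ⟩
  coeff (p +ₚ r) n ℤ.+ coeff (s +ₚ t) n
    ≡⟨ cong₂ ℤ._+_ (coeff-+ₚ p r n) (coeff-+ₚ s t n) ⟩
  (coeff p n ℤ.+ coeff r n) ℤ.+ (coeff s n ℤ.+ coeff t n)
    ≡⟨ interchange (coeff p n) (coeff r n) (coeff s n) (coeff t n) ⟩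
  (coeff p n ℤ.+ coeff s n) ℤ.+ (coeff r n ℤ.+ coeff t n)
    ≡⟨ cong₂ ℤ._+_ (coeff-+ₚ p s n) (coeff-+ₚ r t n) ⟨
  coeff (p +ₚ s) n ℤ.+ coeff (r +ₚ t) n
    ≡⟨ coeff-+ₚ (p +ₚ s) (r +ₚ t) n ⟨
  coeff ((p +ₚ s) +ₚ (r +ₚ t)) n
    ∎
  where open ≡-Reasoning

*ₚ-zeroˡ : ∀ {p} r → p ≋ 0ₚ → p *ₚ r ≋ 0ₚ
*ₚ-zeroˡ {[]}    r e = ≋-refl
*ₚ-zeroˡ {a ∷ p} r e =
  +ₚ-cong (scale-zero r (coeff≡ e zero))
          (≋-sym (0ₚ≋0∷ (≋-sym (*ₚ-zeroˡ {p} r (coeffwise λ n → coeff≡ e (suc n))))))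

*ₚ-zeroʳ : ∀ p → p *ₚ 0ₚ ≋ 0ₚ
*ₚ-zeroʳ []      = ≋-refl
*ₚ-zeroʳ (a ∷ p) = ≋-sym (0ₚ≋0∷ (≋-sym (*ₚ-zeroʳ p)))

*ₚ-congˡ : ∀ {p p′} r → p ≋ p′ → p *ₚ r ≋ p′ *ₚ r
*ₚ-congˡ {[]}    {p′}     r e = ≋-sym (*ₚ-zeroˡ r (≋-sym e))
*ₚ-congˡ {a ∷ p} {[]}     r e = *ₚ-zeroˡ r e
*ₚ-congˡ {a ∷ p} {b ∷ p′} r e =
  +ₚ-cong (≡⇒≋ (cong (λ c → scale c r) (coeff≡ e zero))) (∷-cong refl (*ₚ-congˡ r (∷-tail e)))

*ₚ-congʳ : ∀ p {r r′} → r ≋ r′ → p *ₚ r ≋ p *ₚ r′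
*ₚ-congʳ []      e = ≋-refl
*ₚ-congʳ (a ∷ p) e = +ₚ-cong (scale-cong a e) (∷-cong refl (*ₚ-congʳ p e))

*ₚ-cong : ∀ {p p′ r r′} → p ≋ p′ → r ≋ r′ → p *ₚ r ≋ p′ *ₚ r′
*ₚ-cong {p′ = p′} {r = r} e f = ≋-trans (*ₚ-congˡ r e) (*ₚ-congʳ p′ f)

*ₚ-distribʳ : ∀ r p s → (p +ₚ s) *ₚ r ≋ p *ₚ r +ₚ s *ₚ r
*ₚ-distribʳ r []      s       = ≋-refl
*ₚ-distribʳ r (a ∷ p) []      = ≋-sym (+ₚ-identityʳ _)
*ₚ-distribʳ r (a ∷ p) (b ∷ s) =
  ≋-trans (+ₚ-cong (scale-distribʳ a b r) (∷-cong refl (*ₚ-distribʳ r p s)))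
          (+ₚ-interchange (scale a r) (scale b r) (0ℤ ∷ (p *ₚ r)) (0ℤ ∷ (s *ₚ r)))

*ₚ-distribˡ : ∀ p r s → p *ₚ (r +ₚ s) ≋ p *ₚ r +ₚ p *ₚ s
*ₚ-distribˡ []      r s = ≋-refl
*ₚ-distribˡ (a ∷ p) r s =
  ≋-trans (+ₚ-cong (scale-distribˡ a r s) (∷-cong refl (*ₚ-distribˡ p r s)))
          (+ₚ-interchange (scale a r) (scale a s) (0ℤ ∷ (p *ₚ r)) (0ℤ ∷ (p *ₚ s)))

*ₚ-∷ʳ : ∀ p b r → p *ₚ (b ∷ r) ≋ scale b p +ₚ (0ℤ ∷ (p *ₚ r))
*ₚ-∷ʳ []      b r = 0ₚ≋0∷ ≋-refl
*ₚ-∷ʳ (a ∷ p) b r = ∷-cong head (begin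
  scale a r +ₚ p *ₚ (b ∷ r)                     ≈⟨ +ₚ-cong (≋-refl {scale a r}) (*ₚ-∷ʳ p b r) ⟩
  scale a r +ₚ (scale b p +ₚ (0ℤ ∷ (p *ₚ r)))   ≈⟨ +ₚ-assoc (scale a r) (scale b p) _ ⟨
  (scale a r +ₚ scale b p) +ₚ (0ℤ ∷ (p *ₚ r))   ≈⟨ +ₚ-cong (+ₚ-comm (scale a r) (scale b p)) ≋-refl ⟩
  (scale b p +ₚ scale a r) +ₚ (0ℤ ∷ (p *ₚ r))   ≈⟨ +ₚ-assoc (scale b p) (scale a r) _ ⟩
  scale b p +ₚ (scale a r +ₚ (0ℤ ∷ (p *ₚ r)))   ∎)
  where
  open ≋-Reasoning
  head : a ℤ.* b ℤ.+ 0ℤ ≡ b ℤ.* a ℤ.+ 0ℤ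
  head = cong (ℤ._+ 0ℤ) (ℤP.*-comm a b)

*ₚ-comm : ∀ p r → p *ₚ r ≋ r *ₚ p
*ₚ-comm []      r = ≋-sym (*ₚ-zeroʳ r)
*ₚ-comm (a ∷ p) r = ≋-trans (+ₚ-cong ≋-refl (∷-cong refl (*ₚ-comm p r))) (≋-sym (*ₚ-∷ʳ r a p))

scale-*ₚ : ∀ a r s → scale a r *ₚ s ≋ scale a (r *ₚ s)
scale-*ₚ a []      s = ≋-refl
scale-*ₚ a (b ∷ r) s = ≋-trans
  (+ₚ-cong head (∷-cong (sym (ℤP.*-zeroʳ a)) (scale-*ₚ a r s)))
  (≋-sym (scale-distribˡ a (scale b s) (0ℤ ∷ (r *ₚ s))))
  where
  head : scale (a ℤ.* b) s ≋ scale a (scale b s)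
  head = coeffwise λ n → begin
    coeff (scale (a ℤ.* b) s) n   ≡⟨ coeff-scale (a ℤ.* b) s n ⟩
    a ℤ.* b ℤ.* coeff s n         ≡⟨ ℤP.*-assoc a b (coeff s n) ⟩
    a ℤ.* (b ℤ.* coeff s n)       ≡⟨ cong (ℤ._*_ a) (coeff-scale b s n) ⟨
    a ℤ.* coeff (scale b s) n     ≡⟨ coeff-scale a (scale b s) n ⟨
    coeff (scale a (scale b s)) n ∎
    where open ≡-Reasoning

*ₚ-assoc : ∀ p r s → (p *ₚ r) *ₚ s ≋ p *ₚ (r *ₚ s)
*ₚ-assoc []      r s = ≋-refl
*ₚ-assoc (a ∷ p) r s = ≋-trans (*ₚ-distribʳ s (scale a r) (0ℤ ∷ (p *ₚ r)))
  (+ₚ-cong (scale-*ₚ a r s) (+ₚ-cong (scale-zero s refl) (∷-cong refl (*ₚ-assoc p r s))))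

*ₚ-identityˡ : ∀ p → 1ₚ *ₚ p ≋ p
*ₚ-identityˡ p = coeffwise λ n → begin
  coeff (scale 1ℤ p +ₚ (0ℤ ∷ [])) n            ≡⟨ coeff-+ₚ (scale 1ℤ p) (0ℤ ∷ []) n ⟩
  coeff (scale 1ℤ p) n ℤ.+ coeff (0ℤ ∷ []) n  ≡⟨ cong₂ ℤ._+_ (coeff-scale 1ℤ p n) (coeff-0∷[] n) ⟩
  1ℤ ℤ.* coeff p n ℤ.+ 0ℤ                     ≡⟨ ℤP.+-identityʳ _ ⟩
  1ℤ ℤ.* coeff p n                            ≡⟨ ℤP.*-identityˡ _ ⟩
  coeff p n                                   ∎
  where
  open ≡-Reasoning
  coeff-0∷[] : ∀ n → coeff (0ℤ ∷ []) n ≡ 0ℤ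
  coeff-0∷[] zero    = refl
  coeff-0∷[] (suc n) = refl

*ₚ-identityʳ : ∀ p → p *ₚ 1ₚ ≋ p
*ₚ-identityʳ p = ≋-trans (*ₚ-comm p 1ₚ) (*ₚ-identityˡ p)

ℤ[q] : CommutativeRing 0ℓ 0ℓ
ℤ[q] = record
  { Carrier = Poly ; _≈_ = _≋_ ; _+_ = _+ₚ_ ; _*_ = _*ₚ_ ; -_ = -ₚ_ ; 0# = 0ₚ ; 1# = 1ₚ
  ; isCommutativeRing = record
    { isRing = record
      { +-isAbelianGroup = record
        { isGroup = record
          { isMonoid = record
            { isSemigroup = record
              { isMagma = record { isEquivalence = Setoid.isEquivalence ≋-setoid ; ∙-cong = +ₚ-cong }
              ; assoc = +ₚ-assoc }
            ; identity = +ₚ-identityˡ , +ₚ-identityʳ }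
          ; inverse = -ₚ-inverseˡ , -ₚ-inverseʳ
          ; ⁻¹-cong = -ₚ-cong }
        ; comm = +ₚ-comm }
      ; *-cong = *ₚ-cong
      ; *-assoc = *ₚ-assoc
      ; *-identity = *ₚ-identityˡ , *ₚ-identityʳ
      ; distrib = *ₚ-distribˡ , *ₚ-distribʳ }
    ; *-comm = *ₚ-comm } }

constₚ-morphism : ℤ.+-*-rawRing -Raw-AlmostCommutative⟶ fromCommutativeRing ℤ[q]
constₚ-morphism = record
  { ⟦_⟧    = constₚ
  ; +-homo = λ _ _ → ≋-refl
  ; *-homo = λ a b → ∷-cong (sym (ℤP.+-identityʳ (a ℤ.* b))) ≋-refl
  ; -‿homo = λ _ → ≋-refl
  ; 0-homo = ≋-sym (0ₚ≋0∷ ≋-refl)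
  ; 1-homo = ≋-refl }

constₚ-≟ : ∀ a b → Maybe (constₚ a ≋ constₚ b)
constₚ-≟ a b with a ℤ.≟ b
... | yes refl = just ≋-refl
... | no  _    = nothing

module ℤ[q]-Solver =
  Algebra.Solver.Ring ℤ.+-*-rawRing (fromCommutativeRing ℤ[q]) constₚ-morphism constₚ-≟

-- Paths of D^{L^B} and the entries of L^B

P-injective : ∀ {i j} → P i ≡ P j → i ≡ j
P-injective refl = refl

Q-injective : ∀ {i j} → Q i ≡ Q j → i ≡ j
Q-injective refl = refl

P'-injective : ∀ {i j} → P' i ≡ P' j → i ≡ j
P'-injective refl = refl

middle : ∀ {u v} → Path u v → Maybe ℕ
middle (PQ c ∷ _)  = just c
middle (PQ↑ c ∷ _) = just c
middle _           = nothing

data Route : ∀ {i j} → Path (P i) (P' j) → Set where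
  direct : Route (P1P'0 ∷ [])
  via    : ∀ {i c j} (a : Arc (P i) (Q c)) (b : Arc (Q c) (P' j)) → Route (a ∷ b ∷ [])

Q→P'-single-arc : ∀ {c j} (q : Path (Q c) (P' j)) → ∃[ b ] q ≡ b ∷ []
Q→P'-single-arc (b ∷ [])              = b , refl
Q→P'-single-arc (QP' _ ∷ () ∷ _)
Q→P'-single-arc (QP'↑ _ ∷ () ∷ _)
Q→P'-single-arc (Q1l ∷ () ∷ _)
Q→P'-single-arc (Q1r ∷ () ∷ _)

route : ∀ {i j} (p : Path (P i) (P' j)) → Route p
route (P1P'0 ∷ []) = direct
route (PQ i ∷ q) with Q→P'-single-arc q
... | b , refl = via (PQ i) b
route (PQ↑ i ∷ q) with Q→P'-single-arc q
... | b , refl = via (PQ↑ i) b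

middle-via : ∀ {i c j} (a : Arc (P i) (Q c)) (b : Arc (Q c) (P' j)) → middle (a ∷ b ∷ []) ≡ just c
middle-via (PQ _)  _ = refl
middle-via (PQ↑ _) _ = refl

PQ-bounds : ∀ {i c} → Arc (P i) (Q c) → c ≤ i × i ≤ suc c
PQ-bounds (PQ i)  = ℕP.≤-refl , ℕP.n≤1+n i
PQ-bounds (PQ↑ i) = ℕP.n≤1+n i , ℕP.≤-refl

QP'-bounds : ∀ {c j} → Arc (Q c) (P' j) → j ≤ c
QP'-bounds (QP' _)  = ℕP.≤-refl
QP'-bounds (QP'↑ j) = ℕP.n≤1+n (suc j)
QP'-bounds Q1l      = z≤n
QP'-bounds Q1r      = z≤n

middle-arcs : ∀ {i j c} (p : Path (P i) (P' j)) → middle p ≡ just c → Arc (P i) (Q c) × Arc (Q c) (P' j)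
middle-arcs p eq with route p
middle-arcs _ () | direct
middle-arcs _ eq | via a b with trans (sym (middle-via a b)) eq
... | refl = a , b

middle≤start : ∀ {i j c} (p : Path (P i) (P' j)) → middle p ≡ just c → c ≤ i
middle≤start p eq = proj₁ (PQ-bounds (proj₁ (middle-arcs p eq)))

start≤1+middle : ∀ {i j c} (p : Path (P i) (P' j)) → middle p ≡ just c → i ≤ suc c
start≤1+middle p eq = proj₂ (PQ-bounds (proj₁ (middle-arcs p eq)))

end≤middle : ∀ {i j c} (p : Path (P i) (P' j)) → middle p ≡ just c → j ≤ c
end≤middle p eq = QP'-bounds (proj₂ (middle-arcs p eq))

∈-vertices : ∀ {i j x} (p : Path (P i) (P' j)) → x ∈ vertices p →
  x ≡ P i ⊎ x ≡ P' j ⊎ ∃[ c ] x ≡ Q c × middle p ≡ just c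
∈-vertices p x∈ with route p
∈-vertices _ (here refl)                 | direct  = inj₁ refl
∈-vertices _ (there (here refl))         | direct  = inj₂ (inj₁ refl)
∈-vertices _ (here refl)                 | via a b = inj₁ refl
∈-vertices _ (there (here refl))         | via a b = inj₂ (inj₂ (_ , refl , middle-via a b))
∈-vertices _ (there (there (here refl))) | via a b = inj₂ (inj₁ refl)

Q-middle∈vertices : ∀ {i j c} (p : Path (P i) (P' j)) → middle p ≡ just c → Q c ∈ vertices p
Q-middle∈vertices p eq with route p
Q-middle∈vertices _ () | direct
Q-middle∈vertices _ eq | via a b with trans (sym (middle-via a b)) eq
... | refl = there (here refl)

data Position : ℕ → ℕ → Set where
  upper    : ∀ {i j} → i < j → Position i j
  diagonal : ∀ i → Position i i
  sub      : ∀ c → Position (suc c) c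
  subsub   : ∀ c → Position (suc (suc c)) c
  lower    : ∀ {i j} → suc (suc j) < i → Position i j

position : ∀ i j → Position i j
position zero    zero    = diagonal 0
position zero    (suc j) = upper (s≤s z≤n)
position (suc i) zero    = column₀ i
  where
  column₀ : ∀ i → Position (suc i) 0
  column₀ zero          = sub 0
  column₀ (suc zero)    = subsub 0
  column₀ (suc (suc i)) = lower (s≤s (s≤s (s≤s z≤n)))
position (suc i) (suc j) with position i j
... | upper i<j   = upper (s≤s i<j)
... | diagonal _  = diagonal _
... | sub c       = sub (suc c)
... | subsub c    = subsub (suc c)
... | lower j+2<i = lower (s≤s j+2<i)

pathsAt : ∀ {i j} → Position i j → List (Path (P i) (P' j))
pathsAt (upper _)        = []
pathsAt (diagonal i)     = (PQ i ∷ QP' i ∷ []) ∷ []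
pathsAt (sub zero)       =
  (P1P'0 ∷ []) ∷ (PQ 1 ∷ Q1l ∷ []) ∷ (PQ 1 ∷ Q1r ∷ []) ∷ (PQ↑ 0 ∷ QP' 0 ∷ []) ∷ []
pathsAt (sub (suc j))    = (PQ (suc (suc j)) ∷ QP'↑ j ∷ []) ∷ (PQ↑ (suc j) ∷ QP' (suc j) ∷ []) ∷ []
pathsAt (subsub zero)    = (PQ↑ 1 ∷ Q1l ∷ []) ∷ (PQ↑ 1 ∷ Q1r ∷ []) ∷ []
pathsAt (subsub (suc j)) = (PQ↑ (suc (suc j)) ∷ QP'↑ j ∷ []) ∷ []
pathsAt (lower _)        = []

paths : (i j : ℕ) → List (Path (P i) (P' j))
paths i j = pathsAt (position i j)

position-diagonal : ∀ i → position i i ≡ diagonal i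
position-diagonal zero    = refl
position-diagonal (suc i) rewrite position-diagonal i = refl

position-sub : ∀ c → position (suc c) c ≡ sub c
position-sub zero    = refl
position-sub (suc c) rewrite position-sub c = refl

position-subsub : ∀ c → position (suc (suc c)) c ≡ subsub c
position-subsub zero    = refl
position-subsub (suc c) rewrite position-subsub c = refl

position-upper : ∀ {i j} → i < j → ∃[ i<j ] position i j ≡ upper i<j
position-upper {zero}  {suc j} _ = _ , refl
position-upper {suc i} {suc j} (s≤s i<j) with position-upper i<j
... | _ , eq rewrite eq = _ , refl

position-lower : ∀ {i j} → suc (suc j) < i → ∃[ j+2<i ] position i j ≡ lower j+2<i
position-lower {suc (suc zero)}    {zero}  (s≤s (s≤s ()))
position-lower {suc (suc (suc i))} {zero}  _ = _ , refl
position-lower {suc i}             {suc j} (s≤s j+2<i) with position-lower j+2<i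
... | _ , eq rewrite eq = _ , refl

paths-position : ∀ {i j} (v : Position i j) → paths i j ≡ pathsAt v
paths-position (upper i<j)   = cong pathsAt (proj₂ (position-upper i<j))
paths-position (diagonal i)  = cong pathsAt (position-diagonal i)
paths-position (sub c)       = cong pathsAt (position-sub c)
paths-position (subsub c)    = cong pathsAt (position-subsub c)
paths-position (lower j+2<i) = cong pathsAt (proj₂ (position-lower j+2<i))

∈-paths : ∀ {i j} (p : Path (P i) (P' j)) → p ∈ paths i j
∈-paths p with route p
... | direct = here refl
∈-paths _ | via (PQ i) (QP' .i) rewrite position-diagonal i = here refl
∈-paths _ | via (PQ .(suc (suc j))) (QP'↑ j) rewrite position-sub (suc j) = here refl
∈-paths _ | via (PQ .1) Q1l = there (here refl)
∈-paths _ | via (PQ .1) Q1r = there (there (here refl))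
∈-paths _ | via (PQ↑ zero) (QP' .0) = there (there (there (here refl)))
∈-paths _ | via (PQ↑ (suc j)) (QP' .(suc j)) rewrite position-sub (suc j) = there (here refl)
∈-paths _ | via (PQ↑ .(suc (suc j))) (QP'↑ j) rewrite position-subsub (suc j) = here refl
∈-paths _ | via (PQ↑ .1) Q1l = here refl
∈-paths _ | via (PQ↑ .1) Q1r = there (here refl)

paths-unique : ∀ i j → Unique (paths i j)
paths-unique i j = unique (position i j)
  where
  unique : ∀ {i j} (v : Position i j) → Unique (pathsAt v)
  unique (upper _)        = []
  unique (diagonal i)     = [] ∷ []
  unique (sub zero)       =
    ((λ ()) ∷ (λ ()) ∷ (λ ()) ∷ []) ∷ ((λ ()) ∷ (λ ()) ∷ []) ∷ ((λ ()) ∷ []) ∷ [] ∷ []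
  unique (sub (suc j))    = ((λ ()) ∷ []) ∷ [] ∷ []
  unique (subsub zero)    = ((λ ()) ∷ []) ∷ [] ∷ []
  unique (subsub (suc j)) = [] ∷ []
  unique (lower _)        = []

LB-upper : ∀ {i j} → i < j → LB i j ≡ 0ₚ
LB-upper {zero}           {suc j}             _ = refl
LB-upper {suc zero}       {suc zero}          (s≤s ())
LB-upper {suc zero}       {suc (suc j)}       _ = refl
LB-upper {suc (suc zero)} {suc zero}          (s≤s ())
LB-upper {suc (suc zero)} {suc (suc zero)}    (s≤s (s≤s ()))
LB-upper {suc (suc zero)} {suc (suc (suc j))} _ = refl
LB-upper {suc (suc (suc i))} {suc j} (s≤s 3+i≤j)
  rewrite ≢-≟-identity ℕ._≟_ (ℕP.<⇒≢ {suc i} {j} (ℕP.≤-trans (ℕP.n≤1+n _) 3+i≤j))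
        | ≢-≟-identity ℕ._≟_ (ℕP.<⇒≢ {suc (suc i)} {j} 3+i≤j)
        | ≢-≟-identity ℕ._≟_ (ℕP.<⇒≢ {suc i} {suc j} (ℕP.m<n⇒m<1+n (ℕP.≤-trans (ℕP.n≤1+n _) 3+i≤j)))
  = refl

LB-lower : ∀ {i j} → suc (suc j) < i → LB i j ≡ 0ₚ
LB-lower {suc zero}          {zero}  (s≤s ())
LB-lower {suc (suc zero)}    {zero}  (s≤s (s≤s ()))
LB-lower {suc (suc (suc i))} {zero}  _ = refl
LB-lower {suc (suc (suc i))} {suc j} (s≤s (s≤s (s≤s j<i)))
  rewrite ≢-≟-identity ℕ._≟_ (ℕP.>⇒≢ {suc i} {j} (ℕP.m<n⇒m<1+n j<i))
        | ≢-≟-identity ℕ._≟_ (ℕP.>⇒≢ {suc (suc i)} {j} (ℕP.m<n⇒m<1+n (ℕP.m<n⇒m<1+n j<i)))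
        | ≢-≟-identity ℕ._≟_ (ℕP.>⇒≢ {suc i} {suc j} (s≤s j<i))
  = refl

-- The number of arcs Q_{c+1} → P'_c.
downArcs : ℕ → Poly
downArcs zero    = 1ₚ +ₚ 1ₚ
downArcs (suc _) = 1ₚ

entryAt : ∀ {i j} → Position i j → Poly
entryAt (upper _)    = 0ₚ
entryAt (diagonal _) = 1ₚ
entryAt (sub _)      = 1ₚ +ₚ qₚ
entryAt (subsub c)   = qₚ *ₚ downArcs c
entryAt (lower _)    = 0ₚ

LB-position : ∀ {i j} (v : Position i j) → LB i j ≡ entryAt v
LB-position (upper i<j) = LB-upper i<j
LB-position (diagonal zero) = refl
LB-position (diagonal (suc zero)) = refl
LB-position (diagonal (suc (suc zero))) = refl
LB-position (diagonal (suc (suc (suc i)))) with suc i ℕ.≟ suc (suc i)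
... | yes i≡1+i = contradiction i≡1+i (ℕP.<⇒≢ (ℕP.n<1+n (suc i)))
... | no _ with suc (suc i) ℕ.≟ suc (suc i)
...   | yes _   = refl
...   | no i≢i  = contradiction refl i≢i
LB-position (sub zero) = refl
LB-position (sub (suc zero)) = refl
LB-position (sub (suc (suc j))) with suc j ℕ.≟ suc j
... | yes _   = refl
... | no j≢j  = contradiction refl j≢j
LB-position (subsub zero) = refl
LB-position (subsub (suc j))
  rewrite ≢-≟-identity ℕ._≟_ (ℕP.1+n≢n {j})
        | ≢-≟-identity ℕ._≟_ (ℕP.>⇒≢ {suc (suc j)} {j} (ℕP.m<n⇒m<1+n (ℕP.n<1+n j)))
  with suc j ℕ.≟ suc j
... | yes _   = refl
... | no j≢j  = contradiction refl j≢j
LB-position (lower j+2<i) = LB-lower j+2<i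

-- Families of paths, enumerated by their first path

infixr 5 _∷ₚ_

-- No trailing 0ₚ, so a sum over an explicit list of paths is literally a ring expression.

∑ : {A : Set} → List A → (A → Poly) → Poly
∑ []           f = 0ₚ
∑ (x ∷ [])     f = f x
∑ (x ∷ y ∷ xs) f = f x +ₚ ∑ (y ∷ xs) f

syntax ∑ xs (λ x → e) = ∑[ x ∈ xs ] e

anyPath : ∀ {i j} → Path (P i) (P' j) → AnyPath
anyPath {i} {j} p = path (P i) (P' j) p

_∷ₚ_ : ∀ {i j k} → Path (P i) (P' j) → Family k → Family (suc k)
p ∷ₚ f = anyPath p ∷ f

HeadVia : ∀ {k} → ℕ → Family k → Set
HeadVia c []      = ⊥
HeadVia c (h ∷ f) = middle (arcs h) ≡ just c

headVia? : ∀ {k} c → Decidable (HeadVia {k} c)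
headVia? c []      = no λ ()
headVia? c (h ∷ f) = Maybe.≡-dec ℕ._≟_ (middle (arcs h)) (just c)

avoiding : ∀ {k} → Maybe ℕ → List (Family k) → List (Family k)
avoiding nothing  R = R
avoiding (just c) R = filter (¬? ∘ headVia? c) R

extend : ∀ {i j k} → List (Path (P i) (P' j)) → (Path (P i) (P' j) → List (Family k)) →
  List (Family (suc k))
extend []       T = []
extend (p ∷ ps) T = map (p ∷ₚ_) (T p) ++ extend ps T

families : (k : ℕ) → (I J : Fin k → ℕ) → List (Family k)
families zero    I J = [] ∷ []
families (suc k) I J =
  extend (paths (I zero) (J zero)) λ p → avoiding (middle p) (families k (I ∘ suc) (J ∘ suc))

GF-++ : ∀ {k} (xs ys : List (Family k)) → GF (xs ++ ys) ≋ GF xs +ₚ GF ys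
GF-++ []       ys = ≋-refl
GF-++ (x ∷ xs) ys =
  ≋-trans (+ₚ-cong (≋-refl {familyWeight x}) (GF-++ xs ys))
          (≋-sym (+ₚ-assoc (familyWeight x) (GF xs) (GF ys)))

GF-map-∷ₚ : ∀ {i j k} (p : Path (P i) (P' j)) (R : List (Family k)) →
  GF (map (p ∷ₚ_) R) ≋ pathWeight p *ₚ GF R
GF-map-∷ₚ p []      = ≋-sym (*ₚ-zeroʳ (pathWeight p))
GF-map-∷ₚ p (f ∷ R) =
  ≋-trans (+ₚ-cong (≋-refl {pathWeight p *ₚ familyWeight f}) (GF-map-∷ₚ p R))
          (≋-sym (*ₚ-distribˡ (pathWeight p) (familyWeight f) (GF R)))

GF-extend : ∀ {i j k} (ps : List (Path (P i) (P' j))) (T : Path (P i) (P' j) → List (Family k)) →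
  GF (extend ps T) ≋ ∑[ p ∈ ps ] (pathWeight p *ₚ GF (T p))
GF-extend []           T = ≋-refl
GF-extend (p ∷ [])     T =
  ≋-trans (GF-++ (map (p ∷ₚ_) (T p)) []) (≋-trans (+ₚ-identityʳ _) (GF-map-∷ₚ p (T p)))
GF-extend (p ∷ p′ ∷ ps) T =
  ≋-trans (GF-++ (map (p ∷ₚ_) (T p)) (extend (p′ ∷ ps) T))
          (+ₚ-cong (GF-map-∷ₚ p (T p)) (GF-extend (p′ ∷ ps) T))

GF-partition : ∀ {k} {Pr : Pred (Family k) 0ℓ} (P? : Decidable Pr) xs →
  GF xs ≋ GF (filter (¬? ∘ P?) xs) +ₚ GF (filter P? xs)
GF-partition P? [] = ≋-refl
GF-partition P? (x ∷ xs) with P? x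
... | yes _ = begin
  w +ₚ GF xs                   ≈⟨ +ₚ-cong (≋-refl {w}) (GF-partition P? xs) ⟩
  w +ₚ (rejected +ₚ accepted)  ≈⟨ +ₚ-assoc w rejected accepted ⟨
  (w +ₚ rejected) +ₚ accepted  ≈⟨ +ₚ-cong (+ₚ-comm w rejected) (≋-refl {accepted}) ⟩
  (rejected +ₚ w) +ₚ accepted  ≈⟨ +ₚ-assoc rejected w accepted ⟩
  rejected +ₚ (w +ₚ accepted)  ∎
  where
  open ≋-Reasoning
  w rejected accepted : Poly
  w = familyWeight x
  rejected = GF (filter (¬? ∘ P?) xs)
  accepted = GF (filter P? xs)
... | no _ = ≋-trans (+ₚ-cong (≋-refl {familyWeight x}) (GF-partition P? xs))
                    (≋-sym (+ₚ-assoc (familyWeight x) (GF (filter (¬? ∘ P?) xs)) (GF (filter P? xs))))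

GF-filter-all : ∀ {k} {Pr : Pred (Family k) 0ℓ} (P? : Decidable Pr) → (∀ f → Pr f) → ∀ xs →
  GF (filter P? xs) ≋ GF xs
GF-filter-all P? all xs = ≡⇒≋ (cong GF (filter-all P? (All.universal all xs)))

GF-filter-none : ∀ {k} {Pr : Pred (Family k) 0ℓ} (P? : Decidable Pr) → (∀ f → ¬ Pr f) → ∀ xs →
  GF (filter P? xs) ≋ 0ₚ
GF-filter-none P? none xs = ≡⇒≋ (cong GF (filter-none P? (All.universal none xs)))

filter-map : ∀ {A B : Set} {Pr : Pred B 0ℓ} (P? : Decidable Pr) (g : A → B) xs →
  filter P? (map g xs) ≡ map g (filter (P? ∘ g) xs)
filter-map P? g []       = refl
filter-map P? g (x ∷ xs) with P? (g x)
... | yes _ = cong (g x ∷_) (filter-map P? g xs)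
... | no  _ = filter-map P? g xs

filter-extend : ∀ {i j k} {Pr : Pred (Family (suc k)) 0ℓ} (P? : Decidable Pr)
  (ps : List (Path (P i) (P' j))) (T : Path (P i) (P' j) → List (Family k)) →
  filter P? (extend ps T) ≡ extend ps (λ p → filter (P? ∘ (p ∷ₚ_)) (T p))
filter-extend P? []       T = refl
filter-extend P? (p ∷ ps) T = begin
  filter P? (map (p ∷ₚ_) (T p) ++ extend ps T)
    ≡⟨ filter-++ P? (map (p ∷ₚ_) (T p)) (extend ps T) ⟩
  filter P? (map (p ∷ₚ_) (T p)) ++ filter P? (extend ps T)
    ≡⟨ cong₂ _++_ (filter-map P? (p ∷ₚ_) (T p)) (filter-extend P? ps T) ⟩
  map (p ∷ₚ_) (filter (P? ∘ (p ∷ₚ_)) (T p)) ++ extend ps (λ p → filter (P? ∘ (p ∷ₚ_)) (T p)) ∎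
  where open ≡-Reasoning

GF-filter-extend : ∀ {i j k} {Pr : Pred (Family (suc k)) 0ℓ} (P? : Decidable Pr)
  (ps : List (Path (P i) (P' j))) (T : Path (P i) (P' j) → List (Family k)) →
  GF (filter P? (extend ps T)) ≋ ∑[ p ∈ ps ] (pathWeight p *ₚ GF (filter (P? ∘ (p ∷ₚ_)) (T p)))
GF-filter-extend P? ps T = ≋-trans (≡⇒≋ (cong GF (filter-extend P? ps T))) (GF-extend ps _)

∈-extend⁻ : ∀ {i j k} (ps : List (Path (P i) (P' j))) (T : Path (P i) (P' j) → List (Family k)) {x} →
  x ∈ extend ps T → ∃[ p ] ∃[ f ] p ∈ ps × f ∈ T p × x ≡ p ∷ₚ f
∈-extend⁻ (p ∷ ps) T x∈ with ∈-++⁻ (map (p ∷ₚ_) (T p)) x∈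
... | inj₁ x∈map with ∈-map⁻ (p ∷ₚ_) x∈map
...   | f , f∈ , refl = p , f , here refl , f∈ , refl
∈-extend⁻ (p ∷ ps) T x∈ | inj₂ x∈rest with ∈-extend⁻ ps T x∈rest
...   | p′ , f , p′∈ , f∈ , refl = p′ , f , there p′∈ , f∈ , refl

∈-extend⁺ : ∀ {i j k} (ps : List (Path (P i) (P' j))) (T : Path (P i) (P' j) → List (Family k)) {p f} →
  p ∈ ps → f ∈ T p → p ∷ₚ f ∈ extend ps T
∈-extend⁺ (p ∷ ps) T (here refl) f∈ = ∈-++⁺ˡ (∈-map⁺ (p ∷ₚ_) f∈)
∈-extend⁺ (p ∷ ps) T (there p∈) f∈ = ∈-++⁺ʳ (map (p ∷ₚ_) (T p)) (∈-extend⁺ ps T p∈ f∈)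

extend-unique : ∀ {i j k} {ps : List (Path (P i) (P' j))} (T : Path (P i) (P' j) → List (Family k)) →
  Unique ps → (∀ p → Unique (T p)) → Unique (extend ps T)
extend-unique {ps = []}     T []               uT = []
extend-unique {ps = p ∷ ps} T (p∉ps ∷ uniqueps) uT =
  Unique.++⁺ (Unique.map⁺ ∷ₚ-injectiveʳ (uT p)) (extend-unique T uniqueps uT) disjoint
  where
  ∷ₚ-injectiveʳ : ∀ {f f′} → p ∷ₚ f ≡ p ∷ₚ f′ → f ≡ f′
  ∷ₚ-injectiveʳ refl = refl
  disjoint : ∀ {x} → ¬ (x ∈ map (p ∷ₚ_) (T p) × x ∈ extend ps T)
  disjoint (x∈map , x∈rest) with ∈-map⁻ (p ∷ₚ_) x∈map | ∈-extend⁻ ps T x∈rest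
  ... | _ , _ , refl | _ , _ , p∈ps , _ , refl = All.lookup p∉ps p∈ps refl

Avoids : ∀ {k} → Maybe ℕ → Family k → Set
Avoids nothing  f = ⊤
Avoids (just c) f = ¬ HeadVia c f

∈-avoiding⁻ : ∀ {k} c {R : List (Family k)} {f} → f ∈ avoiding c R → f ∈ R × Avoids c f
∈-avoiding⁻ nothing  f∈ = f∈ , tt
∈-avoiding⁻ (just c) f∈ = ∈-filter⁻ (¬? ∘ headVia? c) f∈

∈-avoiding⁺ : ∀ {k} c {R : List (Family k)} {f} → f ∈ R → Avoids c f → f ∈ avoiding c R
∈-avoiding⁺ nothing  f∈ _  = f∈
∈-avoiding⁺ (just c) f∈ av = ∈-filter⁺ (¬? ∘ headVia? c) f∈ av

tails : ∀ {k} → (Fin (suc k) → ℕ) → (Fin (suc k) → ℕ) → List (Family k)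
tails {k} I J = families k (I ∘ suc) (J ∘ suc)

∈-families⁻ : ∀ {k} (I J : Fin (suc k) → ℕ) {f} → f ∈ families (suc k) I J →
  ∃[ p ] ∃[ f′ ] f′ ∈ avoiding (middle p) (tails I J) × f ≡ p ∷ₚ f′
∈-families⁻ I J f∈ with ∈-extend⁻ (paths (I zero) (J zero)) _ f∈
... | p , f′ , _ , f′∈ , f≡ = p , f′ , f′∈ , f≡

families-unique : ∀ k (I J : Fin k → ℕ) → Unique (families k I J)
families-unique zero    I J = [] ∷ []
families-unique (suc k) I J =
  extend-unique _ (paths-unique (I zero) (J zero))
    λ p → avoiding-unique (middle p) (families-unique k (I ∘ suc) (J ∘ suc))
  where
  avoiding-unique : ∀ c {R : List (Family k)} → Unique R → Unique (avoiding c R)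
  avoiding-unique nothing  uR = uR
  avoiding-unique (just c) uR = Unique.filter⁺ (¬? ∘ headVia? c) uR

headVia-bounds : ∀ {k} (I J : Fin (suc k) → ℕ) {f c} → f ∈ families (suc k) I J → HeadVia c f →
  J zero ≤ c × I zero ≤ suc c
headVia-bounds I J f∈ viaQc with ∈-families⁻ I J f∈
... | p , _ , _ , refl = end≤middle p viaQc , start≤1+middle p viaQc

avoiding-families : ∀ k (I J : Fin k → ℕ) c → (∀ a → c < J a) ⊎ (∀ a → suc c < I a) →
  avoiding (just c) (families k I J) ≡ families k I J
avoiding-families zero    I J c _      = refl
avoiding-families (suc k) I J c bounds = filter-all (¬? ∘ headVia? c) (All.tabulate avoids)
  where
  avoids : ∀ {f} → f ∈ families (suc k) I J → ¬ HeadVia c f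
  avoids f∈ viaQc with headVia-bounds I J f∈ viaQc
  ... | J₀≤c , I₀≤c+1 =
    [ (λ c<J → ℕP.<⇒≱ (c<J zero) J₀≤c) , (λ c+1<I → ℕP.<⇒≱ (c+1<I zero) I₀≤c+1) ] bounds

-- Laplace expansion along the first row

signed-cong : ∀ m {p r} → p ≋ r → signed m p ≋ signed m r
signed-cong zero    e = e
signed-cong (suc m) e = -ₚ-cong (signed-cong m e)

signed-zero : ∀ m {p} → p ≋ 0ₚ → signed m p ≋ 0ₚ
signed-zero m e = ≋-trans (signed-cong m e) (≡⇒≋ (signed-0ₚ m))
  where
  signed-0ₚ : ∀ m → signed m 0ₚ ≡ 0ₚ
  signed-0ₚ zero    = refl
  signed-0ₚ (suc m) = cong -ₚ_ (signed-0ₚ m)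

sumFin-zero : ∀ n {f : Fin n → Poly} → (∀ b → f b ≋ 0ₚ) → sumFin n f ≋ 0ₚ
sumFin-zero zero    e = ≋-refl
sumFin-zero (suc n) e = ≋-trans (+ₚ-cong (e zero) (sumFin-zero n (λ b → e (suc b)))) (+ₚ-identityˡ 0ₚ)

minor : ∀ {n} → (Fin (suc n) → Fin (suc n) → Poly) → Fin (suc n) → Fin n → Fin n → Poly
minor M b r c = M (suc r) (punchIn b c)

cofactorTerm : ∀ n → (Fin (suc n) → Fin (suc n) → Poly) → Fin (suc n) → Poly
cofactorTerm n M b = signed (toℕ b) (M zero b *ₚ det n (minor M b))

det-zero-column : ∀ n (M : Fin (suc n) → Fin (suc n) → Poly) → (∀ r → M r zero ≋ 0ₚ) →
  det (suc n) M ≋ 0ₚ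

cofactorTerm-zero-column : ∀ {n} (M : Fin (suc n) → Fin (suc n) → Poly) →
  (∀ r → M (suc r) zero ≋ 0ₚ) → ∀ b → cofactorTerm n M (suc b) ≋ 0ₚ
cofactorTerm-zero-column {suc n} M col₀ b = signed-zero (toℕ (suc b))
  (≋-trans (*ₚ-congʳ (M zero (suc b)) (det-zero-column n (minor M (suc b)) col₀))
           (*ₚ-zeroʳ (M zero (suc b))))

det-zero-column n M col₀ = sumFin-zero (suc n) vanish
  where
  vanish : ∀ b → cofactorTerm n M b ≋ 0ₚ
  vanish zero    = signed-zero 0 (*ₚ-zeroˡ _ (col₀ zero))
  vanish (suc b) = cofactorTerm-zero-column M (λ r → col₀ (suc r)) b

-- det L^B_{I,J} is the generating function of the enumerated families

DetIsGF : ℕ → Set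
DetIsGF k = ∀ (I J : Fin k → ℕ) → StrictlyIncreasing I → StrictlyIncreasing J →
  det k (subLB I J) ≋ GF (families k I J)

increasing-tail : ∀ {k} {I : Fin (suc k) → ℕ} → StrictlyIncreasing I → StrictlyIncreasing (I ∘ suc)
increasing-tail inc a b a<b = inc (suc a) (suc b) (s≤s a<b)

head<tail : ∀ {k} {I : Fin (suc k) → ℕ} → StrictlyIncreasing I → ∀ a → I zero < I (suc a)
head<tail inc a = inc zero (suc a) (s≤s z≤n)

head≤ : ∀ {k} {I : Fin (suc k) → ℕ} → StrictlyIncreasing I → ∀ a → I zero ≤ I a
head≤ inc zero    = ℕP.≤-refl
head≤ inc (suc a) = ℕP.<⇒≤ (head<tail inc a)

increasing-∘punchIn : ∀ {k} {J : Fin (suc k) → ℕ} → StrictlyIncreasing J →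
  ∀ b → StrictlyIncreasing (J ∘ punchIn b)
increasing-∘punchIn inc b x y x<y = inc (punchIn b x) (punchIn b y)
  (FinP.≤∧≢⇒< (FinP.punchIn-mono-≤ b x y (ℕP.<⇒≤ x<y)) (FinP.<⇒≢ x<y ∘ FinP.punchIn-injective b x y))

head≡⇒<tail : ∀ {k} {I : Fin (suc k) → ℕ} → StrictlyIncreasing I → ∀ {c} → I zero ≡ c → ∀ a → c < I (suc a)
head≡⇒<tail inc I₀≡c a = subst (_< _) I₀≡c (head<tail inc a)

pathSum : ∀ {i j} → List (Path (P i) (P' j)) → (Maybe ℕ → Poly) → Poly
pathSum ps F = ∑[ p ∈ ps ] (pathWeight p *ₚ F (middle p))

right-summand≋0 : ∀ {G F U} → G ≋ F +ₚ U → F ≋ G → U ≋ 0ₚ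
right-summand≋0 {G} {F} {U} G≋F+U F≋G = begin
  U                     ≈⟨ solve 2 (λ f u → u := (f :+ u) :+ (:- f)) ≋-refl F U ⟩
  (F +ₚ U) +ₚ (-ₚ F)    ≈⟨ +ₚ-cong (≋-sym G≋F+U) (-ₚ-cong F≋G) ⟩
  G +ₚ (-ₚ G)           ≈⟨ -ₚ-inverseʳ G ⟩
  0ₚ                    ∎
  where
  open ≋-Reasoning
  open ℤ[q]-Solver

pathSum-diagonal : ∀ i F → pathSum (pathsAt (diagonal i)) F ≋ F (just i)
pathSum-diagonal i F = *ₚ-identityˡ (F (just i))

pathSum-subsub : ∀ c F → pathSum (pathsAt (subsub c)) F ≋ (qₚ *ₚ downArcs c) *ₚ F (just (suc c))
pathSum-subsub zero    F =
  solve 2 (λ q f → q :* f :+ q :* f := (q :* (con 1ℤ :+ con 1ℤ)) :* f) ≋-refl qₚ (F (just 1))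
  where open ℤ[q]-Solver
pathSum-subsub (suc c) F = *ₚ-congˡ (F (just (suc (suc c)))) (≋-sym (*ₚ-identityʳ qₚ))

module FirstRow {k} (I J : Fin (suc k) → ℕ) (incI : StrictlyIncreasing I) (incJ : StrictlyIncreasing J) where

  avoidingGF : Maybe ℕ → Poly
  avoidingGF c = GF (avoiding c (tails I J))

  throughGF : ℕ → Poly
  throughGF c = GF (filter (headVia? c) (tails I J))

  tails-partition : ∀ c → GF (tails I J) ≋ avoidingGF (just c) +ₚ throughGF c
  tails-partition c = GF-partition (headVia? c) (tails I J)

  avoidingGF-ends : ∀ {c} → (∀ a → c < J (suc a)) → avoidingGF (just c) ≋ GF (tails I J)
  avoidingGF-ends c<J = ≡⇒≋ (cong GF (avoiding-families k (I ∘ suc) (J ∘ suc) _ (inj₁ c<J)))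

  avoidingGF-starts : ∀ {c} → (∀ a → suc c < I (suc a)) → avoidingGF (just c) ≋ GF (tails I J)
  avoidingGF-starts c+1<I = ≡⇒≋ (cong GF (avoiding-families k (I ∘ suc) (J ∘ suc) _ (inj₂ c+1<I)))

  throughGF-vanishes : ∀ {c} → avoidingGF (just c) ≋ GF (tails I J) → throughGF c ≋ 0ₚ
  throughGF-vanishes {c} avoids = right-summand≋0 (tails-partition c) avoids

  GF-families : ∀ {i j} → I zero ≡ i → J zero ≡ j → (v : Position i j) →
    GF (families (suc k) I J) ≋ pathSum (pathsAt v) avoidingGF
  GF-families refl refl v = ≋-trans (GF-extend (paths (I zero) (J zero)) _)
    (≡⇒≋ (cong (λ ps → pathSum ps avoidingGF) (paths-position v)))

  D₀ : Poly
  D₀ = det k (subLB (I ∘ suc) (J ∘ suc))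

  D₀≋GF-tails : DetIsGF k → D₀ ≋ GF (tails I J)
  D₀≋GF-tails ih = ih (I ∘ suc) (J ∘ suc) (increasing-tail incI) (increasing-tail incJ)

  laterTerm : Fin k → Poly
  laterTerm b = cofactorTerm k (subLB I J) (suc b)

  laterTerm-upper : ∀ b → I zero < J (suc b) → laterTerm b ≋ 0ₚ
  laterTerm-upper b I₀<J =
    signed-zero (suc (toℕ b)) (*ₚ-zeroˡ (det k (minor (subLB I J) (suc b))) (≡⇒≋ (LB-upper I₀<J)))

  LB-head : ∀ {i j} → I zero ≡ i → J zero ≡ j → (v : Position i j) → LB (I zero) (J zero) ≋ entryAt v
  LB-head I₀≡i J₀≡j v = ≡⇒≋ (trans (cong₂ LB I₀≡i J₀≡j) (LB-position v))

  det-leading : (∀ b → laterTerm b ≋ 0ₚ) → det (suc k) (subLB I J) ≋ LB (I zero) (J zero) *ₚ D₀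
  det-leading vanish = ≋-trans (+ₚ-cong ≋-refl (sumFin-zero k vanish)) (+ₚ-identityʳ _)

  GF-filter-families : ∀ {Pr : Pred (Family (suc k)) 0ℓ} (P? : Decidable Pr) {i j} →
    I zero ≡ i → J zero ≡ j → (v : Position i j) →
    GF (filter P? (families (suc k) I J))
      ≋ ∑[ p ∈ pathsAt v ] (pathWeight p *ₚ GF (filter (P? ∘ (p ∷ₚ_)) (avoiding (middle p) (tails I J))))
  GF-filter-families P? refl refl v = ≋-trans (GF-filter-extend P? (paths (I zero) (J zero)) _)
    (≡⇒≋ (cong (λ ps → ∑[ p ∈ ps ] (pathWeight p *ₚ GF (filter (P? ∘ (p ∷ₚ_)) (avoiding (middle p) (tails I J)))))
               (paths-position v)))

  step-upper : I zero < J zero → det (suc k) (subLB I J) ≋ GF (families (suc k) I J)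
  step-upper I₀<J₀ = begin
    det (suc k) (subLB I J)    ≈⟨ sumFin-zero (suc k) firstRow-vanishes ⟩
    0ₚ                         ≈⟨ GF-families refl refl (upper I₀<J₀) ⟨
    GF (families (suc k) I J)  ∎
    where
    open ≋-Reasoning
    firstRow-vanishes : ∀ b → cofactorTerm k (subLB I J) b ≋ 0ₚ
    firstRow-vanishes b = signed-zero (toℕ b) (*ₚ-zeroˡ (det k (minor (subLB I J) b))
      (≡⇒≋ (LB-upper (ℕP.<-≤-trans I₀<J₀ (head≤ incJ b)))))

  step-lower : suc (suc (J zero)) < I zero → det (suc k) (subLB I J) ≋ GF (families (suc k) I J)
  step-lower J₀+2<I₀ = begin
    det (suc k) (subLB I J)    ≈⟨ det-zero-column k (subLB I J) column₀-vanishes ⟩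
    0ₚ                         ≈⟨ GF-families refl refl (lower J₀+2<I₀) ⟨
    GF (families (suc k) I J)  ∎
    where
    open ≋-Reasoning
    column₀-vanishes : ∀ r → LB (I r) (J zero) ≋ 0ₚ
    column₀-vanishes r = ≡⇒≋ (LB-lower (ℕP.<-≤-trans J₀+2<I₀ (head≤ incI r)))

  step-diagonal : DetIsGF k → I zero ≡ J zero → det (suc k) (subLB I J) ≋ GF (families (suc k) I J)
  step-diagonal ih I₀≡J₀ = begin
    det (suc k) (subLB I J)
      ≈⟨ det-leading (λ b → laterTerm-upper b (subst (_< J (suc b)) (sym I₀≡J₀) (head<tail incJ b))) ⟩
    LB (I zero) (J zero) *ₚ D₀
      ≈⟨ *ₚ-congˡ D₀ (LB-head I₀≡J₀ refl (diagonal (J zero))) ⟩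
    1ₚ *ₚ D₀
      ≈⟨ *ₚ-identityˡ D₀ ⟩
    D₀
      ≈⟨ D₀≋GF-tails ih ⟩
    GF (tails I J)
      ≈⟨ avoidingGF-ends (head≡⇒<tail incJ refl) ⟨
    avoidingGF (just (J zero))
      ≈⟨ pathSum-diagonal (J zero) avoidingGF ⟨
    pathSum (pathsAt (diagonal (J zero))) avoidingGF
      ≈⟨ GF-families I₀≡J₀ refl (diagonal (J zero)) ⟨
    GF (families (suc k) I J)
      ∎
    where open ≋-Reasoning

  step-subsub : DetIsGF k → ∀ {c} → I zero ≡ suc (suc c) → J zero ≡ c →
    det (suc k) (subLB I J) ≋ GF (families (suc k) I J)
  step-subsub ih {c} I₀≡c+2 J₀≡c = begin
    det (suc k) (subLB I J)
      ≈⟨ det-leading (cofactorTerm-zero-column (subLB I J) column₀-below) ⟩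
    LB (I zero) (J zero) *ₚ D₀
      ≈⟨ *ₚ-cong (LB-head I₀≡c+2 J₀≡c (subsub c)) (D₀≋GF-tails ih) ⟩
    (qₚ *ₚ downArcs c) *ₚ GF (tails I J)
      ≈⟨ *ₚ-congʳ (qₚ *ₚ downArcs c) (avoidingGF-starts (head≡⇒<tail incI I₀≡c+2)) ⟨
    (qₚ *ₚ downArcs c) *ₚ avoidingGF (just (suc c))
      ≈⟨ pathSum-subsub c avoidingGF ⟨
    pathSum (pathsAt (subsub c)) avoidingGF
      ≈⟨ GF-families I₀≡c+2 J₀≡c (subsub c) ⟨
    GF (families (suc k) I J)
      ∎
    where
    open ≋-Reasoning
    column₀-below : ∀ r → LB (I (suc r)) (J zero) ≋ 0ₚ
    column₀-below r = ≡⇒≋ (LB-lower (subst₂ (λ j i → suc (suc j) < i) (sym J₀≡c) refl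
      (subst (_< I (suc r)) I₀≡c+2 (head<tail incI r))))

  GF-families-sub : ∀ {c} → I zero ≡ suc c → J zero ≡ c →
    GF (families (suc k) I J) ≋ (1ₚ +ₚ qₚ) *ₚ GF (tails I J) +ₚ -ₚ (downArcs c *ₚ throughGF (suc c))
  GF-families-sub {zero} I₀≡1 J₀≡0 = begin
    GF (families (suc k) I J)
      ≈⟨ GF-families I₀≡1 J₀≡0 (sub 0) ⟩
    pathSum (pathsAt (sub 0)) avoidingGF
      ≈⟨ +ₚ-cong (*ₚ-congʳ (constₚ (ℤ.- 1ℤ)) G≋F+U)
                 (+ₚ-cong (≋-refl {1ₚ *ₚ F}) (+ₚ-cong (≋-refl {1ₚ *ₚ F}) (*ₚ-congʳ qₚ F₀≋F+U))) ⟩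
    constₚ (ℤ.- 1ℤ) *ₚ (F +ₚ U) +ₚ (1ₚ *ₚ F +ₚ (1ₚ *ₚ F +ₚ qₚ *ₚ (F +ₚ U)))
      ≈⟨ solve 3 (λ f u q → con (ℤ.- 1ℤ) :* (f :+ u) :+ (con 1ℤ :* f :+ (con 1ℤ :* f :+ q :* (f :+ u)))
                           := (con 1ℤ :+ q) :* (f :+ u) :+ :- ((con 1ℤ :+ con 1ℤ) :* u)) ≋-refl F U qₚ ⟩
    (1ₚ +ₚ qₚ) *ₚ (F +ₚ U) +ₚ -ₚ (downArcs 0 *ₚ U)
      ≈⟨ +ₚ-cong (*ₚ-congʳ (1ₚ +ₚ qₚ) G≋F+U) ≋-refl ⟨
    (1ₚ +ₚ qₚ) *ₚ GF (tails I J) +ₚ -ₚ (downArcs 0 *ₚ U)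
      ∎
    where
    open ≋-Reasoning
    open ℤ[q]-Solver
    F U : Poly
    F = avoidingGF (just 1)
    U = throughGF 1
    G≋F+U : GF (tails I J) ≋ F +ₚ U
    G≋F+U = tails-partition 1
    F₀≋F+U : avoidingGF (just 0) ≋ F +ₚ U
    F₀≋F+U = ≋-trans (avoidingGF-ends (head≡⇒<tail incJ J₀≡0)) G≋F+U
  GF-families-sub {suc c} I₀≡c+2 J₀≡c+1 = begin
    GF (families (suc k) I J)
      ≈⟨ GF-families I₀≡c+2 J₀≡c+1 (sub (suc c)) ⟩
    pathSum (pathsAt (sub (suc c))) avoidingGF
      ≈⟨ +ₚ-cong (≋-refl {1ₚ *ₚ F}) (*ₚ-congʳ qₚ F₁≋F+U) ⟩
    1ₚ *ₚ F +ₚ qₚ *ₚ (F +ₚ U)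
      ≈⟨ solve 3 (λ f u q → con 1ℤ :* f :+ q :* (f :+ u) := (con 1ℤ :+ q) :* (f :+ u) :+ :- (con 1ℤ :* u))
                 ≋-refl F U qₚ ⟩
    (1ₚ +ₚ qₚ) *ₚ (F +ₚ U) +ₚ -ₚ (downArcs (suc c) *ₚ U)
      ≈⟨ +ₚ-cong (*ₚ-congʳ (1ₚ +ₚ qₚ) G≋F+U) ≋-refl ⟨
    (1ₚ +ₚ qₚ) *ₚ GF (tails I J) +ₚ -ₚ (downArcs (suc c) *ₚ U)
      ∎
    where
    open ≋-Reasoning
    open ℤ[q]-Solver
    F U : Poly
    F = avoidingGF (just (suc (suc c)))
    U = throughGF (suc (suc c))
    G≋F+U : GF (tails I J) ≋ F +ₚ U
    G≋F+U = tails-partition (suc (suc c))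
    F₁≋F+U : avoidingGF (just (suc c)) ≋ F +ₚ U
    F₁≋F+U = ≋-trans (avoidingGF-ends (head≡⇒<tail incJ J₀≡c+1)) G≋F+U

  GF-through-sub : ∀ {c} → I zero ≡ suc (suc c) → J zero ≡ suc c →
    GF (filter (headVia? (suc c)) (families (suc k) I J)) ≋ qₚ *ₚ avoidingGF (just (suc c))
  GF-through-sub {c} I₀≡c+2 J₀≡c+1 = begin
    GF (filter via? (families (suc k) I J))
      ≈⟨ GF-filter-families via? I₀≡c+2 J₀≡c+1 (sub (suc c)) ⟩
    pathWeight p₁ *ₚ GF (filter (via? ∘ (p₁ ∷ₚ_)) R₁) +ₚ pathWeight p₂ *ₚ GF (filter (via? ∘ (p₂ ∷ₚ_)) R₂)
      ≈⟨ +ₚ-cong (≋-trans (*ₚ-congʳ (pathWeight p₁) (GF-filter-none (via? ∘ (p₁ ∷ₚ_)) p₁-misses R₁))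
                          (*ₚ-zeroʳ (pathWeight p₁)))
                 (*ₚ-congʳ (pathWeight p₂) (GF-filter-all (via? ∘ (p₂ ∷ₚ_)) (λ _ → refl) R₂)) ⟩
    0ₚ +ₚ qₚ *ₚ avoidingGF (just (suc c))
      ∎
    where
    open ≋-Reasoning
    p₁ p₂ : Path (P (suc (suc c))) (P' (suc c))
    p₁ = PQ (suc (suc c)) ∷ QP'↑ c ∷ []
    p₂ = PQ↑ (suc c) ∷ QP' (suc c) ∷ []
    R₁ R₂ : List (Family k)
    R₁ = avoiding (just (suc (suc c))) (tails I J)
    R₂ = avoiding (just (suc c)) (tails I J)
    via? : Decidable (HeadVia {suc k} (suc c))
    via? = headVia? (suc c)
    p₁-misses : ∀ f → ¬ HeadVia (suc c) (p₁ ∷ₚ f)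
    p₁-misses f via-c+1 = ℕP.1+n≢n (Maybe.just-injective via-c+1)

module _ {k} (I J : Fin (suc (suc k)) → ℕ) (incI : StrictlyIncreasing I) (incJ : StrictlyIncreasing J)
         (ih : DetIsGF (suc k)) where

  private
    I′ J′ : Fin (suc k) → ℕ
    I′ = I ∘ suc
    J′ = J ∘ punchIn (suc zero)
    incI′ : StrictlyIncreasing I′
    incI′ = increasing-tail incI
    incJ′ : StrictlyIncreasing J′
    incJ′ = increasing-∘punchIn incJ (suc zero)
    module Minor = FirstRow I′ J′ incI′ incJ′
    module Tail = FirstRow I′ (J ∘ suc) incI′ (increasing-tail incJ)
    open FirstRow I J incI incJ

  -- The minor of l_{i_1,j_2} is, definitionally, the submatrix of L^B with rows I′ and columns J′.
  secondMinor-GF : ∀ {c} → I zero ≡ suc c → J zero ≡ c → J (suc zero) ≡ suc c →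
    det (suc k) (minor (subLB I J) (suc zero)) ≋ downArcs c *ₚ throughGF (suc c)
  secondMinor-GF {c} I₀≡c+1 J₀≡c J₁≡c+1 with ℕP.<-cmp (suc (suc c)) (I (suc zero))
  ... | tri< c+2<I₁ _ _ = begin
    det (suc k) (subLB I′ J′)                      ≈⟨ ih I′ J′ incI′ incJ′ ⟩
    GF (families (suc k) I′ J′)                    ≈⟨ Minor.GF-families refl J₀≡c (lower c+2<I₁) ⟩
    0ₚ                                             ≈⟨ *ₚ-zeroʳ (downArcs c) ⟨
    downArcs c *ₚ 0ₚ                               ≈⟨ *ₚ-congʳ (downArcs c) (throughGF-vanishes (avoidingGF-starts c+2<I)) ⟨
    downArcs c *ₚ throughGF (suc c)                ∎
    where
    open ≋-Reasoning
    c+2<I : ∀ a → suc (suc c) < I (suc a)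
    c+2<I a = ℕP.<-≤-trans c+2<I₁ (head≤ incI′ a)
  ... | tri≈ _ c+2≡I₁ _ = begin
    det (suc k) (subLB I′ J′)                      ≈⟨ ih I′ J′ incI′ incJ′ ⟩
    GF (families (suc k) I′ J′)                    ≈⟨ Minor.GF-families (sym c+2≡I₁) J₀≡c (subsub c) ⟩
    pathSum (pathsAt (subsub c)) Minor.avoidingGF  ≈⟨ pathSum-subsub c Minor.avoidingGF ⟩
    (qₚ *ₚ downArcs c) *ₚ F                        ≈⟨ *ₚ-congˡ F (*ₚ-comm qₚ (downArcs c)) ⟩
    (downArcs c *ₚ qₚ) *ₚ F                        ≈⟨ *ₚ-assoc (downArcs c) qₚ F ⟩
    downArcs c *ₚ (qₚ *ₚ F)                        ≈⟨ *ₚ-congʳ (downArcs c) (Tail.GF-through-sub (sym c+2≡I₁) J₁≡c+1) ⟨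
    downArcs c *ₚ throughGF (suc c)                ∎
    where
    open ≋-Reasoning
    F : Poly
    F = Minor.avoidingGF (just (suc c))
  ... | tri> _ _ I₁<c+2 =
    contradiction (ℕP.≤-pred I₁<c+2) (ℕP.<⇒≱ (subst (_< I (suc zero)) I₀≡c+1 (head<tail incI zero)))

laterTerms-sub : ∀ {k} (I J : Fin (suc k) → ℕ) (incI : StrictlyIncreasing I) (incJ : StrictlyIncreasing J) →
  DetIsGF k → ∀ {c} → I zero ≡ suc c → J zero ≡ c →
  sumFin k (FirstRow.laterTerm I J incI incJ) ≋ -ₚ (downArcs c *ₚ FirstRow.throughGF I J incI incJ (suc c))
laterTerms-sub {zero}   I J incI incJ ih {c} _ _ = ≋-sym (-ₚ-cong (*ₚ-zeroʳ (downArcs c)))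
laterTerms-sub {suc k′} I J incI incJ ih {c} I₀≡c+1 J₀≡c with ℕP.<-cmp (suc c) (J (suc zero))
... | tri< c+1<J₁ _ _ = begin
  sumFin (suc k′) laterTerm            ≈⟨ sumFin-zero (suc k′) (λ b → laterTerm-upper b (I₀<J b)) ⟩
  0ₚ                                   ≈⟨ -ₚ-cong (*ₚ-zeroʳ (downArcs c)) ⟨
  -ₚ (downArcs c *ₚ 0ₚ)                ≈⟨ -ₚ-cong (*ₚ-congʳ (downArcs c) (throughGF-vanishes (avoidingGF-ends c+1<J))) ⟨
  -ₚ (downArcs c *ₚ throughGF (suc c)) ∎
  where
  open ≋-Reasoning
  open FirstRow I J incI incJ
  c+1<J : ∀ a → suc c < J (suc a)
  c+1<J a = ℕP.<-≤-trans c+1<J₁ (head≤ (increasing-tail incJ) a)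
  I₀<J : ∀ b → I zero < J (suc b)
  I₀<J b = subst (_< J (suc b)) (sym I₀≡c+1) (c+1<J b)
... | tri≈ _ c+1≡J₁ _ = begin
  -ₚ (LB (I zero) (J (suc zero)) *ₚ X) +ₚ sumFin k′ (laterTerm ∘ suc)
    ≈⟨ +ₚ-cong (-ₚ-cong (*ₚ-congˡ X (≡⇒≋ LB₀₁≡1))) (sumFin-zero k′ (λ b → laterTerm-upper (suc b) (I₀<J b))) ⟩
  -ₚ (1ₚ *ₚ X) +ₚ 0ₚ                   ≈⟨ +ₚ-identityʳ _ ⟩
  -ₚ (1ₚ *ₚ X)                         ≈⟨ -ₚ-cong (*ₚ-identityˡ X) ⟩
  -ₚ X                                 ≈⟨ -ₚ-cong (secondMinor-GF I J incI incJ ih I₀≡c+1 J₀≡c (sym c+1≡J₁)) ⟩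
  -ₚ (downArcs c *ₚ throughGF (suc c)) ∎
  where
  open ≋-Reasoning
  open FirstRow I J incI incJ
  X : Poly
  X = det (suc k′) (minor (subLB I J) (suc zero))
  LB₀₁≡1 : LB (I zero) (J (suc zero)) ≡ 1ₚ
  LB₀₁≡1 = trans (cong₂ LB I₀≡c+1 (sym c+1≡J₁)) (LB-position (diagonal (suc c)))
  I₀<J : ∀ b → I zero < J (suc (suc b))
  I₀<J b = subst (_< J (suc (suc b))) (trans (sym c+1≡J₁) (sym I₀≡c+1)) (head<tail (increasing-tail incJ) b)
... | tri> _ _ J₁<c+1 =
  contradiction (ℕP.≤-pred J₁<c+1) (ℕP.<⇒≱ (subst (_< J (suc zero)) J₀≡c (head<tail incJ zero)))

step-sub : ∀ {k} (I J : Fin (suc k) → ℕ) (incI : StrictlyIncreasing I) (incJ : StrictlyIncreasing J) →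
  DetIsGF k → ∀ {c} → I zero ≡ suc c → J zero ≡ c →
  det (suc k) (subLB I J) ≋ GF (families (suc k) I J)
step-sub {k} I J incI incJ ih {c} I₀≡c+1 J₀≡c = begin
  LB (I zero) (J zero) *ₚ D₀ +ₚ sumFin k laterTerm
    ≈⟨ +ₚ-cong (*ₚ-cong (LB-head I₀≡c+1 J₀≡c (sub c)) (D₀≋GF-tails ih))
               (laterTerms-sub I J incI incJ ih I₀≡c+1 J₀≡c) ⟩
  (1ₚ +ₚ qₚ) *ₚ GF (tails I J) +ₚ -ₚ (downArcs c *ₚ throughGF (suc c))
    ≈⟨ GF-families-sub I₀≡c+1 J₀≡c ⟨
  GF (families (suc k) I J)
    ∎
  where
  open ≋-Reasoning
  open FirstRow I J incI incJ

det≋GF-families : ∀ k → DetIsGF k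
det≋GF-families zero    I J _ _ = ≋-refl
det≋GF-families (suc k) I J incI incJ = byPosition refl refl (position (I zero) (J zero))
  where
  open FirstRow I J incI incJ
  ih : DetIsGF k
  ih = det≋GF-families k
  byPosition : ∀ {i j} → I zero ≡ i → J zero ≡ j → Position i j →
    det (suc k) (subLB I J) ≋ GF (families (suc k) I J)
  byPosition I₀≡i   J₀≡j (upper i<j)   = step-upper (subst₂ _<_ (sym I₀≡i) (sym J₀≡j) i<j)
  byPosition I₀≡i   J₀≡i (diagonal _)  = step-diagonal ih (trans I₀≡i (sym J₀≡i))
  byPosition I₀≡c+1 J₀≡c (sub _)       = step-sub I J incI incJ ih I₀≡c+1 J₀≡c
  byPosition I₀≡c+2 J₀≡c (subsub _)    = step-subsub ih I₀≡c+2 J₀≡c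
  byPosition I₀≡i   J₀≡j (lower j+2<i) =
    step-lower (subst₂ (λ j i → suc (suc j) < i) (sym J₀≡j) (sym I₀≡i) j+2<i)

-- The enumerated families are exactly the nonintersecting ones

Connects : ∀ {k} → (Fin k → ℕ) → (Fin k → ℕ) → Family k → Set
Connects I J f = ∀ m → Σ[ p ∈ Path (P (I m)) (P' (J m)) ] lookup f m ≡ anyPath p

families-connect : ∀ k (I J : Fin k → ℕ) {f} → f ∈ families k I J → Connects I J f
families-connect (suc k) I J f∈ with ∈-families⁻ I J f∈
... | p , f′ , f′∈ , refl = λ where
  zero    → p , refl
  (suc m) → families-connect k (I ∘ suc) (J ∘ suc) (proj₁ (∈-avoiding⁻ (middle p) f′∈)) m

module _ {k} {I J : Fin (suc k) → ℕ} (incI : StrictlyIncreasing I) (incJ : StrictlyIncreasing J)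
         (p : Path (P (I zero)) (P' (J zero))) where

  shared-middle-impossible : ∀ (f : Family k) → Avoids (middle p) f →
    ∀ b {c} {p′ : Path (P (I (suc b))) (P' (J (suc b)))} →
    lookup f b ≡ anyPath p′ → middle p ≡ just c → middle p′ ≡ just c → ⊥
  shared-middle-impossible (h ∷ _) avoids zero f₀≡p′ p-via p′-via rewrite p-via =
    avoids (subst (λ h → middle (arcs h) ≡ just _) (sym f₀≡p′) p′-via)
  shared-middle-impossible f _ (suc b) {c} {p′} _ p-via p′-via = ℕP.<-irrefl refl (begin-strict
    suc c                  ≤⟨ s≤s (middle≤start p p-via) ⟩
    suc (I zero)           ≤⟨ head<tail incI zero ⟩
    I (suc zero)           <⟨ incI (suc zero) (suc (suc b)) (s≤s (s≤s z≤n)) ⟩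
    I (suc (suc b))        ≤⟨ start≤1+middle p′ p′-via ⟩
    suc c                  ∎)
    where open ℕP.≤-Reasoning

  head-disjoint : ∀ {f : Family k} → Connects (I ∘ suc) (J ∘ suc) f → Avoids (middle p) f →
    ∀ b {x} → x ∈ vertices p → x ∈ vertices (arcs (lookup f b)) → ⊥
  head-disjoint {f} connects avoids b x∈p x∈f with connects b
  ... | p′ , f_b≡p′ with ∈-vertices p x∈p | ∈-vertices p′ (subst (λ h → _ ∈ vertices (arcs h)) f_b≡p′ x∈f)
  ... | inj₁ refl | inj₁ eq = ℕP.<-irrefl (P-injective eq) (head<tail incI b)
  ... | inj₂ (inj₁ refl) | inj₂ (inj₁ eq) = ℕP.<-irrefl (P'-injective eq) (head<tail incJ b)
  ... | inj₂ (inj₂ (c , refl , p-via)) | inj₂ (inj₂ (c′ , eq , p′-via)) with Q-injective eq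
  ...   | refl = shared-middle-impossible f avoids b f_b≡p′ p-via p′-via
  head-disjoint _ _ b x∈p x∈f | p′ , _ | inj₁ refl | inj₂ (inj₁ ())
  head-disjoint _ _ b x∈p x∈f | p′ , _ | inj₁ refl | inj₂ (inj₂ (_ , () , _))
  head-disjoint _ _ b x∈p x∈f | p′ , _ | inj₂ (inj₁ refl) | inj₁ ()
  head-disjoint _ _ b x∈p x∈f | p′ , _ | inj₂ (inj₁ refl) | inj₂ (inj₂ (_ , () , _))
  head-disjoint _ _ b x∈p x∈f | p′ , _ | inj₂ (inj₂ (_ , refl , _)) | inj₁ ()
  head-disjoint _ _ b x∈p x∈f | p′ , _ | inj₂ (inj₂ (_ , refl , _)) | inj₂ (inj₁ ())

families-disjoint : ∀ k (I J : Fin k → ℕ) → StrictlyIncreasing I → StrictlyIncreasing J → ∀ {f} →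
  f ∈ families k I J → ∀ m m′ → ¬ m ≡ m′ → ∀ x →
  x ∈ vertices (arcs (lookup f m)) → x ∈ vertices (arcs (lookup f m′)) → ⊥
families-disjoint (suc k) I J incI incJ f∈ with ∈-families⁻ I J f∈
... | p , f′ , f′∈ , refl = disjoint
  where
  f′∈tails : f′ ∈ tails I J
  f′∈tails = proj₁ (∈-avoiding⁻ (middle p) f′∈)
  connects : Connects (I ∘ suc) (J ∘ suc) f′
  connects = families-connect k (I ∘ suc) (J ∘ suc) f′∈tails
  avoids : Avoids (middle p) f′
  avoids = proj₂ (∈-avoiding⁻ (middle p) f′∈)
  disjoint : ∀ m m′ → ¬ m ≡ m′ → ∀ x →
    x ∈ vertices (arcs (lookup (p ∷ₚ f′) m)) → x ∈ vertices (arcs (lookup (p ∷ₚ f′) m′)) → ⊥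
  disjoint zero    zero     m≢m′ = contradiction refl m≢m′
  disjoint zero    (suc b)  _    x x∈p x∈f = head-disjoint incI incJ p connects avoids b x∈p x∈f
  disjoint (suc b) zero     _    x x∈f x∈p = head-disjoint incI incJ p connects avoids b x∈p x∈f
  disjoint (suc a) (suc b)  m≢m′ =
    families-disjoint k (I ∘ suc) (J ∘ suc) (increasing-tail incI) (increasing-tail incJ) f′∈tails
                      a b (m≢m′ ∘ cong suc)

families-sound : ∀ k (I J : Fin k → ℕ) → StrictlyIncreasing I → StrictlyIncreasing J → ∀ {f} →
  f ∈ families k I J → Nonintersecting I J f
families-sound k I J incI incJ {f} f∈ = endpoints , families-disjoint k I J incI incJ f∈
  where
  endpoints : ∀ m → start (lookup f m) ≡ P (I m) × end (lookup f m) ≡ P' (J m)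
  endpoints m with families-connect k I J f∈ m
  ... | _ , f_m≡p = cong start f_m≡p , cong end f_m≡p

disjoint⇒avoids : ∀ {k i j i′ j′} (p : Path (P i) (P' j)) (h : AnyPath) (f : Family k) →
  start h ≡ P i′ → end h ≡ P' j′ → (∀ x → x ∈ vertices p → x ∈ vertices (arcs h) → ⊥) →
  Avoids (middle p) (h ∷ f)
disjoint⇒avoids p h f start≡ end≡ disjoint with middle p in p-via
... | nothing = tt
disjoint⇒avoids p (path _ _ q) f refl refl disjoint | just c =
  λ q-via → disjoint (Q c) (Q-middle∈vertices p p-via) (Q-middle∈vertices q q-via)

nonintersecting⇒avoids : ∀ {k} {I J : Fin (suc k) → ℕ} (p : Path (P (I zero)) (P' (J zero))) (f : Family k) →
  Nonintersecting I J (p ∷ₚ f) → Avoids (middle p) f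
nonintersecting⇒avoids p [] _ with middle p
... | nothing = tt
... | just c  = λ ()
nonintersecting⇒avoids p (h ∷ f) (endpoints , disjoint) =
  disjoint⇒avoids p h f (proj₁ (endpoints (suc zero))) (proj₂ (endpoints (suc zero)))
                  (disjoint zero (suc zero) (λ ()))

families-complete : ∀ k (I J : Fin k → ℕ) {f} → Nonintersecting I J f → f ∈ families k I J
families-complete zero    I J {[]}           _ = here refl
families-complete (suc k) I J {path _ _ p ∷ f} nonint@(endpoints , disjoint) with endpoints zero
... | refl , refl = ∈-extend⁺ (paths (I zero) (J zero)) _ (∈-paths p)
                      (∈-avoiding⁺ (middle p) tail∈ (nonintersecting⇒avoids p f nonint))
  where
  tail∈ : f ∈ families k (I ∘ suc) (J ∘ suc)
  tail∈ = families-complete k (I ∘ suc) (J ∘ suc)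
    ((endpoints ∘ suc) , λ m m′ m≢m′ → disjoint (suc m) (suc m′) (m≢m′ ∘ FinP.suc-injective))

-- Cancellation of the families with (𝒫₁), (𝒫₂) or (𝒫₃)

directPath leftPath : AnyPath
directPath = anyPath (P1P'0 ∷ [])
leftPath   = anyPath (PQ 1 ∷ Q1l ∷ [])

shiftPath : ℕ → AnyPath
shiftPath m = anyPath (PQ↑ m ∷ QP' m ∷ [])

turnPath : ℕ → AnyPath
turnPath u = anyPath (PQ (suc (suc u)) ∷ QP'↑ u ∷ [])

≟directPath : ∀ h → Dec (h ≡ directPath)
≟directPath (path _ _ [])                 = no λ ()
≟directPath (path _ _ (PQ _ ∷ _))         = no λ ()
≟directPath (path _ _ (PQ↑ _ ∷ _))        = no λ ()
≟directPath (path _ _ (QP' _ ∷ _))        = no λ ()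
≟directPath (path _ _ (QP'↑ _ ∷ _))       = no λ ()
≟directPath (path _ _ (P1P'0 ∷ []))       = yes refl
≟directPath (path _ _ (P1P'0 ∷ () ∷ _))
≟directPath (path _ _ (Q1l ∷ _))          = no λ ()
≟directPath (path _ _ (Q1r ∷ _))          = no λ ()

≟leftPath : ∀ h → Dec (h ≡ leftPath)
≟leftPath (path _ _ [])                         = no λ ()
≟leftPath (path _ _ (PQ _ ∷ []))                = no λ ()
≟leftPath (path _ _ (PQ _ ∷ QP' _ ∷ _))         = no λ ()
≟leftPath (path _ _ (PQ _ ∷ QP'↑ _ ∷ _))        = no λ ()
≟leftPath (path _ _ (PQ _ ∷ Q1l ∷ []))          = yes refl
≟leftPath (path _ _ (PQ _ ∷ Q1l ∷ () ∷ _))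
≟leftPath (path _ _ (PQ _ ∷ Q1r ∷ _))           = no λ ()
≟leftPath (path _ _ (PQ↑ _ ∷ _))                = no λ ()
≟leftPath (path _ _ (QP' _ ∷ _))                = no λ ()
≟leftPath (path _ _ (QP'↑ _ ∷ _))               = no λ ()
≟leftPath (path _ _ (P1P'0 ∷ _))                = no λ ()
≟leftPath (path _ _ (Q1l ∷ _))                  = no λ ()
≟leftPath (path _ _ (Q1r ∷ _))                  = no λ ()

≟shiftPath : ∀ m h → Dec (h ≡ shiftPath m)
≟shiftPath m (path _ _ [])                      = no λ ()
≟shiftPath m (path _ _ (PQ _ ∷ _))              = no λ ()
≟shiftPath m (path _ _ (PQ↑ _ ∷ []))            = no λ ()
≟shiftPath m (path _ _ (PQ↑ i ∷ QP' _ ∷ [])) with i ℕ.≟ m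
... | yes refl = yes refl
... | no  i≢m  = no λ h≡ → i≢m (ℕP.suc-injective (P-injective (cong start h≡)))
≟shiftPath m (path _ _ (PQ↑ _ ∷ QP' _ ∷ () ∷ _))
≟shiftPath m (path _ _ (PQ↑ _ ∷ QP'↑ _ ∷ _))    = no λ ()
≟shiftPath m (path _ _ (PQ↑ _ ∷ Q1l ∷ _))       = no λ ()
≟shiftPath m (path _ _ (PQ↑ _ ∷ Q1r ∷ _))       = no λ ()
≟shiftPath m (path _ _ (QP' _ ∷ _))             = no λ ()
≟shiftPath m (path _ _ (QP'↑ _ ∷ _))            = no λ ()
≟shiftPath m (path _ _ (P1P'0 ∷ _))             = no λ ()
≟shiftPath m (path _ _ (Q1l ∷ _))               = no λ ()
≟shiftPath m (path _ _ (Q1r ∷ _))               = no λ ()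

≟turnPath : ∀ u h → Dec (h ≡ turnPath u)
≟turnPath u (path _ _ [])                       = no λ ()
≟turnPath u (path _ _ (PQ _ ∷ []))              = no λ ()
≟turnPath u (path _ _ (PQ _ ∷ QP' _ ∷ _))       = no λ ()
≟turnPath u (path _ _ (PQ _ ∷ QP'↑ c ∷ [])) with c ℕ.≟ u
... | yes refl = yes refl
... | no  c≢u  = no λ h≡ → c≢u (ℕP.suc-injective (ℕP.suc-injective (P-injective (cong start h≡))))
≟turnPath u (path _ _ (PQ _ ∷ QP'↑ _ ∷ () ∷ _))
≟turnPath u (path _ _ (PQ _ ∷ Q1l ∷ _))         = no λ ()
≟turnPath u (path _ _ (PQ _ ∷ Q1r ∷ _))         = no λ ()
≟turnPath u (path _ _ (PQ↑ _ ∷ _))              = no λ ()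
≟turnPath u (path _ _ (QP' _ ∷ _))              = no λ ()
≟turnPath u (path _ _ (QP'↑ _ ∷ _))             = no λ ()
≟turnPath u (path _ _ (P1P'0 ∷ _))              = no λ ()
≟turnPath u (path _ _ (Q1l ∷ _))                = no λ ()
≟turnPath u (path _ _ (Q1r ∷ _))                = no λ ()

-- (𝒫₃) with the first path starting at P_{m+1}; Prop₃ f is Staircase 0 f.
Staircase : ∀ {k} → ℕ → Family k → Set
Staircase {k} m f = Σ[ u ∈ ℕ ] Σ[ t ∈ Fin k ] (m + toℕ t ≡ suc u)
  × ((s : Fin k) → m + toℕ s < suc u → lookup f s ≡ shiftPath (m + toℕ s))
  × (lookup f t ≡ turnPath u)

TurnAt : ℕ → AnyPath → Set
TurnAt m h = Σ[ u ∈ ℕ ] m ≡ suc u × h ≡ turnPath u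

turnAt? : ∀ m h → Dec (TurnAt m h)
turnAt? zero    h = no λ { (_ , () , _) }
turnAt? (suc u) h = map′ (λ h≡ → u , refl , h≡) (λ { (_ , refl , h≡) → h≡ }) (≟turnPath u h)

staircase-turn : ∀ {k} u (f : Family k) → Staircase (suc u) (turnPath u ∷ f)
staircase-turn u f = u , zero , cong suc (ℕP.+-identityʳ u) , below-turn , refl
  where
  below-turn : ∀ s → suc u + toℕ s < suc u → _
  below-turn s u+s<u = contradiction u+s<u (ℕP.≤⇒≯ (ℕP.m≤m+n (suc u) (toℕ s)))

staircase-head : ∀ {k} m h (f : Family k) → Staircase m (h ∷ f) → h ≡ shiftPath m ⊎ TurnAt m h
staircase-head m h f (u , zero , m+0≡u+1 , _ , h≡) = inj₂ (u , trans (sym (ℕP.+-identityʳ m)) m+0≡u+1 , h≡)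
staircase-head m h f (u , suc t , m+t+1≡u+1 , below , _) =
  inj₁ (subst (λ n → h ≡ shiftPath n) (ℕP.+-identityʳ m) (below zero m+0<u+1))
  where
  m+0<u+1 : m + 0 < suc u
  m+0<u+1 = subst (_< suc u) (sym (ℕP.+-identityʳ m))
    (subst (m <_) m+t+1≡u+1 (ℕP.m<m+n m (s≤s z≤n)))

staircase-shift⁻ : ∀ {k} m (f : Family k) → Staircase m (shiftPath m ∷ f) → Staircase (suc m) f
staircase-shift⁻ m f (u , zero , _ , _ , ())
staircase-shift⁻ m f (u , suc t , m+t+1≡u+1 , below , f_t≡) =
  u , t , trans (sym (ℕP.+-suc m (toℕ t))) m+t+1≡u+1 , below′ , f_t≡
  where
  below′ : ∀ s → suc m + toℕ s < suc u → lookup f s ≡ shiftPath (suc m + toℕ s)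
  below′ s lt = subst (λ n → lookup f s ≡ shiftPath n) (ℕP.+-suc m (toℕ s))
    (below (suc s) (subst (_< suc u) (sym (ℕP.+-suc m (toℕ s))) lt))

staircase-shift⁺ : ∀ {k} m (f : Family k) → Staircase (suc m) f → Staircase m (shiftPath m ∷ f)
staircase-shift⁺ m f (u , t , m+1+t≡u+1 , below , f_t≡) =
  u , suc t , trans (ℕP.+-suc m (toℕ t)) m+1+t≡u+1 , below′ , f_t≡
  where
  below′ : ∀ s → m + toℕ s < suc u → lookup (shiftPath m ∷ f) s ≡ shiftPath (m + toℕ s)
  below′ zero    _  = cong shiftPath (sym (ℕP.+-identityʳ m))
  below′ (suc s) lt = subst (λ n → lookup f s ≡ shiftPath n) (sym (ℕP.+-suc m (toℕ s)))
    (below s (subst (_< suc u) (ℕP.+-suc m (toℕ s)) lt))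

staircase? : ∀ {k} m (f : Family k) → Dec (Staircase m f)
staircase? m []      = no λ { (_ , () , _) }
staircase? m (h ∷ f) with turnAt? m h
... | yes (u , refl , refl) = yes (staircase-turn u f)
... | no ¬turn with ≟shiftPath m h
...   | yes refl  = map′ (staircase-shift⁺ m f) (staircase-shift⁻ m f) (staircase? (suc m) f)
...   | no ¬shift = no λ stair → [ ¬shift , ¬turn ] (staircase-head m h f stair)

staircase-endpoints : ∀ {k} m h (f : Family k) → Staircase m (h ∷ f) → start h ≡ P (suc m) × end h ≡ P' m
staircase-endpoints m h f stair with staircase-head m h f stair
... | inj₁ refl              = refl , refl
... | inj₂ (u , refl , refl) = refl , refl

Bad : ∀ {n} → Family (suc n) → Set
Bad f = Prop₁ f ⊎ Prop₂ f ⊎ Prop₃ f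

bad? : ∀ {n} (f : Family (suc n)) → Dec (Bad f)
bad? f = ≟directPath (lookup f zero) ⊎-dec (≟leftPath (lookup f zero) ⊎-dec staircase? 0 f)

bad-endpoints : ∀ {k} h (f : Family k) → Bad (h ∷ f) → start h ≡ P 1 × end h ≡ P' 0
bad-endpoints h f (inj₁ refl)        = refl , refl
bad-endpoints h f (inj₂ (inj₁ refl)) = refl , refl
bad-endpoints h f (inj₂ (inj₂ stair)) = staircase-endpoints 0 h f stair

staircases-elsewhere : ∀ {k} m (I J : Fin (suc k) → ℕ) → ¬ (I zero ≡ suc m × J zero ≡ m) →
  filter (staircase? m) (families (suc k) I J) ≡ []
staircases-elsewhere {k} m I J ¬head = filter-none (staircase? m) (All.tabulate no-staircase)
  where
  no-staircase : ∀ {f} → f ∈ families (suc k) I J → ¬ Staircase m f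
  no-staircase f∈ stair with ∈-families⁻ I J f∈
  ... | p , f′ , _ , refl with staircase-endpoints m (anyPath p) f′ stair
  ...   | start≡ , end≡ = ¬head (P-injective start≡ , P'-injective end≡)

through-elsewhere : ∀ {k} c (I J : Fin (suc k) → ℕ) → suc c ≤ I zero → c ≤ J zero →
  ¬ (I zero ≡ suc c × J zero ≡ c) → filter (headVia? c) (families (suc k) I J) ≡ []
through-elsewhere {k} c I J c+1≤I₀ c≤J₀ ¬head = filter-none (headVia? c) (All.tabulate not-through)
  where
  not-through : ∀ {f} → f ∈ families (suc k) I J → ¬ HeadVia c f
  not-through f∈ through with headVia-bounds I J f∈ through
  ... | J₀≤c , I₀≤c+1 = ¬head (ℕP.≤-antisym I₀≤c+1 c+1≤I₀ , ℕP.≤-antisym J₀≤c c≤J₀)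

module _ {k} (I J : Fin (suc k) → ℕ) (incI : StrictlyIncreasing I) (incJ : StrictlyIncreasing J) {m}
         (I₀≡m+2 : I zero ≡ suc (suc m)) (J₀≡m+1 : J zero ≡ suc m) where

  open FirstRow I J incI incJ

  private
    p₁ p₂ : Path (P (suc (suc m))) (P' (suc m))
    p₁ = PQ (suc (suc m)) ∷ QP'↑ m ∷ []
    p₂ = PQ↑ (suc m) ∷ QP' (suc m) ∷ []
    R₁ R₂ : List (Family k)
    R₁ = avoiding (just (suc (suc m))) (tails I J)
    R₂ = avoiding (just (suc m)) (tails I J)
    m+2<I : ∀ a → suc (suc m) < I (suc a)
    m+2<I = head≡⇒<tail incI I₀≡m+2

  staircase-GF-step :
    qₚ *ₚ GF (filter (staircase? (suc (suc m))) (tails I J)) ≋ throughGF (suc (suc m)) →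
    qₚ *ₚ GF (filter (staircase? (suc m)) (families (suc k) I J))
      ≋ GF (filter (headVia? (suc m)) (families (suc k) I J))
  staircase-GF-step ih = begin
    qₚ *ₚ GF (filter (staircase? (suc m)) (families (suc k) I J))
      ≈⟨ *ₚ-congʳ qₚ (GF-filter-families (staircase? (suc m)) I₀≡m+2 J₀≡m+1 (sub (suc m))) ⟩
    qₚ *ₚ (pathWeight p₁ *ₚ GF (filter (staircase? (suc m) ∘ (p₁ ∷ₚ_)) R₁)
           +ₚ pathWeight p₂ *ₚ GF (filter (staircase? (suc m) ∘ (p₂ ∷ₚ_)) R₂))
      ≈⟨ *ₚ-congʳ qₚ (+ₚ-cong turn-first shift-first) ⟩
    qₚ *ₚ (avoidingGF (just (suc (suc m))) +ₚ qₚ *ₚ GF (filter (staircase? (suc (suc m))) (tails I J)))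
      ≈⟨ *ₚ-congʳ qₚ (+ₚ-cong (≋-refl {avoidingGF (just (suc (suc m)))}) ih) ⟩
    qₚ *ₚ (avoidingGF (just (suc (suc m))) +ₚ throughGF (suc (suc m)))
      ≈⟨ *ₚ-congʳ qₚ (tails-partition (suc (suc m))) ⟨
    qₚ *ₚ GF (tails I J)
      ≈⟨ *ₚ-congʳ qₚ (avoidingGF-starts m+2<I) ⟨
    qₚ *ₚ avoidingGF (just (suc m))
      ≈⟨ GF-through-sub I₀≡m+2 J₀≡m+1 ⟨
    GF (filter (headVia? (suc m)) (families (suc k) I J)) ∎
    where
    open ≋-Reasoning
    turn-first : pathWeight p₁ *ₚ GF (filter (staircase? (suc m) ∘ (p₁ ∷ₚ_)) R₁) ≋ GF R₁
    turn-first = ≋-trans (*ₚ-identityˡ (GF (filter (staircase? (suc m) ∘ (p₁ ∷ₚ_)) R₁)))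
                         (GF-filter-all (staircase? (suc m) ∘ (p₁ ∷ₚ_)) (staircase-turn m) R₁)
    shift-first : pathWeight p₂ *ₚ GF (filter (staircase? (suc m) ∘ (p₂ ∷ₚ_)) R₂)
                  ≋ qₚ *ₚ GF (filter (staircase? (suc (suc m))) (tails I J))
    shift-first = ≡⇒≋ (cong (λ fs → qₚ *ₚ GF fs) (trans
      (filter-≐ (staircase? (suc m) ∘ (p₂ ∷ₚ_)) (staircase? (suc (suc m)))
                ((λ {f} → staircase-shift⁻ (suc m) f) , (λ {f} → staircase-shift⁺ (suc m) f)) R₂)
      (cong (filter (staircase? (suc (suc m)))) (avoiding-families k (I ∘ suc) (J ∘ suc) (suc m) (inj₂ m+2<I)))))

staircase-GF : ∀ k m (I J : Fin k → ℕ) → StrictlyIncreasing I → StrictlyIncreasing J →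
  (∀ a → suc (suc m) ≤ I a) → (∀ a → suc m ≤ J a) →
  qₚ *ₚ GF (filter (staircase? (suc m)) (families k I J)) ≋ GF (filter (headVia? (suc m)) (families k I J))
staircase-GF zero    m I J _    _    _      _      = *ₚ-zeroʳ qₚ
staircase-GF (suc k) m I J incI incJ m+2≤I m+1≤J with I zero ℕ.≟ suc (suc m) ×-dec J zero ℕ.≟ suc m
... | yes (I₀≡m+2 , J₀≡m+1) = staircase-GF-step I J incI incJ I₀≡m+2 J₀≡m+1
  (staircase-GF k (suc m) (I ∘ suc) (J ∘ suc) (increasing-tail incI) (increasing-tail incJ)
     (head≡⇒<tail incI I₀≡m+2) (head≡⇒<tail incJ J₀≡m+1))
... | no ¬head = begin
  qₚ *ₚ GF (filter (staircase? (suc m)) (families (suc k) I J))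
    ≈⟨ *ₚ-congʳ qₚ (≡⇒≋ (cong GF (staircases-elsewhere (suc m) I J ¬head))) ⟩
  qₚ *ₚ 0ₚ
    ≈⟨ *ₚ-zeroʳ qₚ ⟩
  0ₚ
    ≈⟨ ≡⇒≋ (cong GF (through-elsewhere (suc m) I J (m+2≤I zero) (m+1≤J zero) ¬head)) ⟨
  GF (filter (headVia? (suc m)) (families (suc k) I J)) ∎
  where open ≋-Reasoning

bad-elsewhere : ∀ {n} (I J : Fin (suc n) → ℕ) → ¬ (I zero ≡ 1 × J zero ≡ 0) →
  filter bad? (families (suc n) I J) ≡ []
bad-elsewhere {n} I J ¬head = filter-none bad? (All.tabulate not-bad)
  where
  not-bad : ∀ {f} → f ∈ families (suc n) I J → ¬ Bad f
  not-bad f∈ bad with ∈-families⁻ I J f∈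
  ... | p , f′ , _ , refl with bad-endpoints (anyPath p) f′ bad
  ...   | start≡ , end≡ = ¬head (P-injective start≡ , P'-injective end≡)

not-bad-right : ∀ {n} (f : Family n) → ¬ Bad ((PQ 1 ∷ Q1r ∷ []) ∷ₚ f)
not-bad-right f (inj₂ (inj₂ stair)) with staircase-head 0 (anyPath (PQ 1 ∷ Q1r ∷ [])) f stair
... | inj₁ ()
... | inj₂ (_ , () , _)

bad-shift≐staircase : ∀ {n} → (Bad {n} ∘ ((PQ↑ 0 ∷ QP' 0 ∷ []) ∷ₚ_)) ≐ Staircase 1
bad-shift≐staircase = (λ { {f} (inj₂ (inj₂ stair)) → staircase-shift⁻ 0 f stair })
                    , (λ {f} stair → inj₂ (inj₂ (staircase-shift⁺ 0 f stair)))

module _ {n} (I J : Fin (suc n) → ℕ) (incI : StrictlyIncreasing I) (incJ : StrictlyIncreasing J)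
         (I₀≡1 : I zero ≡ 1) (J₀≡0 : J zero ≡ 0) where

  open FirstRow I J incI incJ

  private
    p-direct p-left p-right p-shift : Path (P 1) (P' 0)
    p-direct = P1P'0 ∷ []
    p-left   = PQ 1 ∷ Q1l ∷ []
    p-right  = PQ 1 ∷ Q1r ∷ []
    p-shift  = PQ↑ 0 ∷ QP' 0 ∷ []
    R₀ R₁ : List (Family n)
    R₀ = avoiding (just 0) (tails I J)
    R₁ = avoiding (just 1) (tails I J)
    F U : Poly
    F = avoidingGF (just 1)
    U = throughGF 1

  bad-GF-at-corner : GF (filter bad? (families (suc n) I J)) ≋ 0ₚ
  bad-GF-at-corner = begin
    GF (filter bad? (families (suc n) I J))
      ≈⟨ GF-filter-families bad? I₀≡1 J₀≡0 (sub 0) ⟩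
    pathWeight p-direct *ₚ GF (filter (bad? ∘ (p-direct ∷ₚ_)) (tails I J))
      +ₚ (pathWeight p-left *ₚ GF (filter (bad? ∘ (p-left ∷ₚ_)) R₁)
      +ₚ (pathWeight p-right *ₚ GF (filter (bad? ∘ (p-right ∷ₚ_)) R₁)
      +ₚ pathWeight p-shift *ₚ GF (filter (bad? ∘ (p-shift ∷ₚ_)) R₀)))
      ≈⟨ +ₚ-cong (*ₚ-congʳ (pathWeight p-direct) (GF-filter-all _ (λ _ → inj₁ refl) (tails I J)))
        (+ₚ-cong (*ₚ-congʳ (pathWeight p-left) (GF-filter-all _ (λ _ → inj₂ (inj₁ refl)) R₁))
        (+ₚ-cong right-never-bad (*ₚ-congʳ qₚ shift-bad))) ⟩
    constₚ (ℤ.- 1ℤ) *ₚ GF (tails I J) +ₚ (1ₚ *ₚ F +ₚ qₚ *ₚ GF (filter (staircase? 1) (tails I J)))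
      ≈⟨ +ₚ-cong (*ₚ-congʳ (constₚ (ℤ.- 1ℤ)) (tails-partition 1)) (+ₚ-cong (≋-refl {1ₚ *ₚ F}) shift-through) ⟩
    constₚ (ℤ.- 1ℤ) *ₚ (F +ₚ U) +ₚ (1ₚ *ₚ F +ₚ U)
      ≈⟨ solve 2 (λ f u → con (ℤ.- 1ℤ) :* (f :+ u) :+ (con 1ℤ :* f :+ u) := con 0ℤ) ≋-refl F U ⟩
    constₚ 0ℤ
      ≈⟨ 0ₚ≋0∷ ≋-refl ⟨
    0ₚ
      ∎
    where
    open ≋-Reasoning
    open ℤ[q]-Solver
    right-never-bad : pathWeight p-right *ₚ GF (filter (bad? ∘ (p-right ∷ₚ_)) R₁) ≋ 0ₚ
    right-never-bad = ≋-trans (*ₚ-congʳ (pathWeight p-right) (GF-filter-none _ not-bad-right R₁))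
                              (*ₚ-zeroʳ (pathWeight p-right))
    shift-bad : GF (filter (bad? ∘ (p-shift ∷ₚ_)) R₀) ≋ GF (filter (staircase? 1) (tails I J))
    shift-bad = ≡⇒≋ (cong GF (trans
      (filter-≐ (bad? ∘ (p-shift ∷ₚ_)) (staircase? 1) bad-shift≐staircase R₀)
      (cong (filter (staircase? 1)) (avoiding-families n (I ∘ suc) (J ∘ suc) 0 (inj₂ (head≡⇒<tail incI I₀≡1))))))
    shift-through : qₚ *ₚ GF (filter (staircase? 1) (tails I J)) ≋ U
    shift-through = staircase-GF n 0 (I ∘ suc) (J ∘ suc) (increasing-tail incI) (increasing-tail incJ)
      (head≡⇒<tail incI I₀≡1) (head≡⇒<tail incJ J₀≡0)

bad-GF : ∀ n (I J : Fin (suc n) → ℕ) → StrictlyIncreasing I → StrictlyIncreasing J →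
  GF (filter bad? (families (suc n) I J)) ≋ 0ₚ
bad-GF n I J incI incJ with I zero ℕ.≟ 1 ×-dec J zero ℕ.≟ 0
... | yes (I₀≡1 , J₀≡0) = bad-GF-at-corner I J incI incJ I₀≡1 J₀≡0
... | no ¬corner        = ≡⇒≋ (cong GF (bad-elsewhere I J ¬corner))

-- Nonnegativity

NonNegative : Poly → Set
NonNegative p = ∀ d → 0ℤ ≤ℤ coeff p d

nonNegative-+ₚ : ∀ p r → NonNegative p → NonNegative r → NonNegative (p +ₚ r)
nonNegative-+ₚ p r p≥0 r≥0 d = subst (0ℤ ≤ℤ_) (sym (coeff-+ₚ p r d)) (ℤP.+-mono-≤ (p≥0 d) (r≥0 d))

0≤i∧0≤j⇒0≤i*j : ∀ {a b} → 0ℤ ≤ℤ a → 0ℤ ≤ℤ b → 0ℤ ≤ℤ a ℤ.* b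
0≤i∧0≤j⇒0≤i*j {+ m} {+ n} _ _ = subst (0ℤ ≤ℤ_) (ℤP.pos-* m n) (+≤+ z≤n)

nonNegative-*ₚ : ∀ p r → NonNegative p → NonNegative r → NonNegative (p *ₚ r)
nonNegative-*ₚ []      r p≥0 r≥0 d = ℤP.≤-refl
nonNegative-*ₚ (a ∷ p) r p≥0 r≥0 =
  nonNegative-+ₚ (scale a r) (0ℤ ∷ (p *ₚ r)) scaled shifted
  where
  scaled : NonNegative (scale a r)
  scaled d = subst (0ℤ ≤ℤ_) (sym (coeff-scale a r d)) (0≤i∧0≤j⇒0≤i*j (p≥0 zero) (r≥0 d))
  shifted : NonNegative (0ℤ ∷ (p *ₚ r))
  shifted zero    = ℤP.≤-refl
  shifted (suc d) = nonNegative-*ₚ p r (p≥0 ∘ suc) r≥0 d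

nonNegative-1ₚ : NonNegative 1ₚ
nonNegative-1ₚ zero    = +≤+ z≤n
nonNegative-1ₚ (suc d) = ℤP.≤-refl

nonNegative-qₚ : NonNegative qₚ
nonNegative-qₚ zero          = ℤP.≤-refl
nonNegative-qₚ (suc zero)    = +≤+ z≤n
nonNegative-qₚ (suc (suc d)) = ℤP.≤-refl

Q→P'-weight : ∀ {c j} (b : Arc (Q c) (P' j)) → arcWeight b ≡ 1ₚ
Q→P'-weight (QP' _)  = refl
Q→P'-weight (QP'↑ _) = refl
Q→P'-weight Q1l      = refl
Q→P'-weight Q1r      = refl

pathWeight-nonNegative : ∀ {i j} (p : Path (P i) (P' j)) → anyPath p ≢ directPath → NonNegative (pathWeight p)
pathWeight-nonNegative p ¬direct with route p
... | direct = contradiction refl ¬direct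
... | via a b rewrite Q→P'-weight b =
  nonNegative-*ₚ (arcWeight a) (1ₚ *ₚ 1ₚ) (P→Q-weight a)
                 (nonNegative-*ₚ 1ₚ 1ₚ nonNegative-1ₚ nonNegative-1ₚ)
  where
  P→Q-weight : ∀ {i c} (a : Arc (P i) (Q c)) → NonNegative (arcWeight a)
  P→Q-weight (PQ _)  = nonNegative-1ₚ
  P→Q-weight (PQ↑ _) = nonNegative-qₚ

familyWeight-nonNegative : ∀ {k} (f : Family k) → (∀ m → NonNegative (pathWeight (arcs (lookup f m)))) →
  NonNegative (familyWeight f)
familyWeight-nonNegative []      _   = nonNegative-1ₚ
familyWeight-nonNegative (h ∷ f) h≥0 =
  nonNegative-*ₚ (pathWeight (arcs h)) (familyWeight f) (h≥0 zero) (familyWeight-nonNegative f (h≥0 ∘ suc))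

GF-nonNegative : ∀ {k} (S : List (Family k)) → (∀ {f} → f ∈ S → NonNegative (familyWeight f)) →
  NonNegative (GF S)
GF-nonNegative []      _   d = ℤP.≤-refl
GF-nonNegative (f ∷ S) S≥0 =
  nonNegative-+ₚ (familyWeight f) (GF S) (S≥0 (here refl)) (GF-nonNegative S (S≥0 ∘ there))

goodFamilies : ∀ n → (I J : Fin (suc n) → ℕ) → List (Family (suc n))
goodFamilies n I J = filter (¬? ∘ bad?) (families (suc n) I J)

module _ {n} {I J : Fin (suc n) → ℕ} (incI : StrictlyIncreasing I) (incJ : StrictlyIncreasing J) where

  ∈-goodFamilies⁻ : ∀ {f} → f ∈ goodFamilies n I J → InS I J f
  ∈-goodFamilies⁻ f∈ with ∈-filter⁻ (¬? ∘ bad?) f∈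
  ... | f∈families , ¬bad =
    families-sound (suc n) I J incI incJ f∈families , ¬bad ∘ inj₁ , ¬bad ∘ inj₂ ∘ inj₁ , ¬bad ∘ inj₂ ∘ inj₂

  ∈-goodFamilies⁺ : ∀ {f} → InS I J f → f ∈ goodFamilies n I J
  ∈-goodFamilies⁺ (nonintersecting , ¬𝒫₁ , ¬𝒫₂ , ¬𝒫₃) =
    ∈-filter⁺ (¬? ∘ bad?) (families-complete (suc n) I J nonintersecting) [ ¬𝒫₁ , [ ¬𝒫₂ , ¬𝒫₃ ] ]

  det≋GF-goodFamilies : det (suc n) (subLB I J) ≋ GF (goodFamilies n I J)
  det≋GF-goodFamilies = begin
    det (suc n) (subLB I J)                           ≈⟨ det≋GF-families (suc n) I J incI incJ ⟩
    GF (families (suc n) I J)                         ≈⟨ GF-partition bad? (families (suc n) I J) ⟩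
    GF (goodFamilies n I J) +ₚ GF (filter bad? (families (suc n) I J))
                                                      ≈⟨ +ₚ-cong ≋-refl (bad-GF n I J incI incJ) ⟩
    GF (goodFamilies n I J) +ₚ 0ₚ                     ≈⟨ +ₚ-identityʳ _ ⟩
    GF (goodFamilies n I J)                           ∎
    where open ≋-Reasoning

  good-path-not-direct : ∀ {f} → f ∈ goodFamilies n I J → ∀ m {p : Path (P (I m)) (P' (J m))} →
    lookup f m ≡ anyPath p → anyPath p ≢ directPath
  good-path-not-direct f∈ zero    f₀≡p p≡direct = proj₁ (proj₂ (∈-goodFamilies⁻ f∈)) (trans f₀≡p p≡direct)
  good-path-not-direct f∈ (suc m) _    p≡direct =
    ℕP.n≮0 (subst (J zero ℕ.<_) (P'-injective (cong end p≡direct)) (head<tail incJ m))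

  goodFamily-nonNegative : ∀ {f} → f ∈ goodFamilies n I J → NonNegative (familyWeight f)
  goodFamily-nonNegative {f} f∈ = familyWeight-nonNegative f path≥0
    where
    path≥0 : ∀ m → NonNegative (pathWeight (arcs (lookup f m)))
    path≥0 m with families-connect (suc n) I J (proj₁ (∈-filter⁻ (¬? ∘ bad?) f∈)) m
    ... | p , f_m≡p = subst (NonNegative ∘ pathWeight ∘ arcs) (sym f_m≡p)
                            (pathWeight-nonNegative p (good-path-not-direct f∈ m f_m≡p))

theorem3p2 : (n : ℕ) (I J : Fin (suc n) → ℕ) →
    StrictlyIncreasing I → StrictlyIncreasing J →
    (Σ[ S ∈ List (Family (suc n)) ]
        ((f : Family (suc n)) → (f ∈ S → InS I J f) × (InS I J f → f ∈ S))
      × Unique S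
      × (det (suc n) (subLB I J) ≈ₚ GF S))
    × ((d : ℕ) → 0ℤ ≤ℤ coeff (det (suc n) (subLB I J)) d)
theorem3p2 n I J incI incJ =
  ( goodFamilies n I J
  , (λ f → ∈-goodFamilies⁻ incI incJ , ∈-goodFamilies⁺ incI incJ)
  , Unique.filter⁺ (¬? ∘ bad?) (families-unique (suc n) I J)
  , coeff≡ (det≋GF-goodFamilies incI incJ) )
  , λ d → subst (0ℤ ≤ℤ_) (sym (coeff≡ (det≋GF-goodFamilies incI incJ) d))
                 (GF-nonNegative (goodFamilies n I J) (goodFamily-nonNegative incI incJ) d)
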